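{- Let $\mathbb{F}$ be a field of characteristic zero and let $P$ be a homogeneous polynomial of degree $n$ in $N$ variables over $\mathbb{F}$ with a representation $$P = \sum_{i=1}^{T} \alpha_i \cdot \prod_{j=1}^{d} Q_{ij},$$ where $\alpha_i \in \mathbb{F}$ and each $Q_{ij}$ is a polynomial depending on at most $s$ variables with constant term $0$ or $1$. Then $P$ can be computed by a $\Sigma\Pi\Sigma\wedge\Sigma\Pi$ circuit $C''$ with the following properties: (1) the inputs to the $\wedge$ gates are siblings of the polynomials $\{\mathsf{Hom}^{\geq 1}[Q_{ij}] : 1 \leq i \leq T, 1 \leq j \leq d\}$; (2) the fan-in of the $\times$ gates at the second level from the top is at most $n$; (3) the top fan-in of $C''$ is at most $T d^2 n^3 2^{O(\sqrt{n})}$.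
   Context: A $\Sigma\Pi\Sigma\wedge\Sigma\Pi$ circuit is a layered depth-six arithmetic circuit whose levels, counted from the output (level one) downward, consist of: an addition gate, multiplication gates, addition gates, powering gates $\wedge$ (each computes a power of its single input), addition gates, and multiplication gates of variables; the top fan-in is the fan-in of the output addition gate. $\mathsf{Hom}^{\geq 1}[Q]$ denotes the sum of terms of $Q$ of degree at least $1$. A sibling of a polynomial $R(X_1,\ldots,X_N)$ is a polynomial of the form $R(\beta X_1, \ldots, \beta X_N)$ for some $\beta \in \mathbb{F}$ (in particular it involves the same set of variables as $R$). The $O(\sqrt{n})$ hides an absolute constant. -}

module Defs where

open import Level using (Level; _⊔_)
open import Algebra.Bundles using (CommutativeRing)
open import Data.Nat as ℕ using (ℕ; zero; suc)
open import Data.Nat.Properties using () renaming (_≟_ to _≟ℕ_)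
open import Data.Bool using (Bool; true; false; _∧_)
open import Data.Fin using (Fin)
open import Data.Fin.Subset using (Subset; _∉_; ∣_∣)
open import Data.List as List using (List; []; _∷_; concatMap; map; filter; length)
open import Data.List.Relation.Unary.All using (All)
open import Data.List.Membership.Propositional using (_∈_)
open import Data.Vec as Vec using (Vec; lookup; zipWith; replicate)
open import Data.Vec.Properties using (≡-dec)
open import Data.Product using (Σ; ∃; _×_; _,_; proj₁; proj₂)
open import Data.Sum using (_⊎_)
open import Relation.Nullary using (¬_; yes; no)
open import Relation.Binary.PropositionalEquality using (_≡_; _≢_)

_•1⟨_⟩ : ∀ {a ℓ} → ℕ → (R : CommutativeRing a ℓ) → CommutativeRing.Carrier R
zero •1⟨ R ⟩ = CommutativeRing.0# R
suc n •1⟨ R ⟩ = CommutativeRing._+_ R (CommutativeRing.1# R) (n •1⟨ R ⟩)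

record CharZeroField (a ℓ : Level) : Set (Level.suc (a ⊔ ℓ)) where
  field
    commutativeRing : CommutativeRing a ℓ
  open CommutativeRing commutativeRing public
  field
    0≉1        : ¬ (0# ≈ 1#)
    inverse    : ∀ x → ¬ (x ≈ 0#) → Σ Carrier λ y → x * y ≈ 1#
    charZero   : ∀ n → ¬ ((suc n) •1⟨ commutativeRing ⟩ ≈ 0#)

-- A polynomial is represented by a finite list of terms (c , e) meaning
-- c * X^e; two representations denote the same polynomial iff all their
-- coefficients agree (_≋_ below).

module Poly {a ℓ} (F : CharZeroField a ℓ) where
  open CharZeroField F public

  Monomial : ℕ → Set
  Monomial N = Vec ℕ N

  Pol : ℕ → Set a
  Pol N = List (Carrier × Monomial N)

  _^F_ : Carrier → ℕ → Carrier
  x ^F zero = 1#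
  x ^F suc k = x * (x ^F k)

  mdeg : ∀ {N} → Monomial N → ℕ
  mdeg = Vec.sum

  coeff : ∀ {N} → Pol N → Monomial N → Carrier
  coeff [] m = 0#
  coeff ((c , e) ∷ p) m with ≡-dec _≟ℕ_ e m
  ... | yes _ = c + coeff p m
  ... | no  _ = coeff p m

  _≋_ : ∀ {N} → Pol N → Pol N → Set ℓ
  p ≋ q = ∀ m → coeff p m ≈ coeff q m

  zeroP : ∀ {N} → Pol N
  zeroP = []

  constP : ∀ {N} → Carrier → Pol N
  constP c = (c , replicate _ 0) ∷ []

  _+P_ : ∀ {N} → Pol N → Pol N → Pol N
  p +P q = p List.++ q

  _·P_ : ∀ {N} → Carrier → Pol N → Pol N
  α ·P p = map (λ t → (α * proj₁ t , proj₂ t)) p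

  _*P_ : ∀ {N} → Pol N → Pol N → Pol N
  p *P q = concatMap (λ t → map (λ u → (proj₁ t * proj₁ u , zipWith ℕ._+_ (proj₂ t) (proj₂ u))) q) p

  _^P_ : ∀ {N} → Pol N → ℕ → Pol N
  p ^P zero = constP 1#
  p ^P suc k = p *P (p ^P k)

  sumP : ∀ {N} → List (Pol N) → Pol N
  sumP = List.foldr _+P_ zeroP

  prodP : ∀ {N} → List (Pol N) → Pol N
  prodP = List.foldr _*P_ (constP 1#)

  ΣF : ∀ {N} k → (Fin k → Pol N) → Pol N
  ΣF k f = sumP (List.tabulate f)

  ΠF : ∀ {N} k → (Fin k → Pol N) → Pol N
  ΠF k f = prodP (List.tabulate f)

  Homogeneous : ∀ {N} → ℕ → Pol N → Set ℓ
  Homogeneous n P = ∀ m → mdeg m ≢ n → coeff P m ≈ 0#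

  DependsOnAtMost : ∀ {N} → ℕ → Pol N → Set ℓ
  DependsOnAtMost {N} s P =
    Σ (Subset N) λ S → (∣ S ∣ ℕ.≤ s) ×
      (∀ m → (Σ (Fin N) λ i → (i ∉ S) × (lookup m i ≢ 0)) → coeff P m ≈ 0#)

  constTerm : ∀ {N} → Pol N → Carrier
  constTerm P = coeff P (replicate _ 0)

  isConstMon : ∀ {N} → Monomial N → Bool
  isConstMon Vec.[] = true
  isConstMon (zero Vec.∷ e) = isConstMon e
  isConstMon (suc _ Vec.∷ e) = false

  Hom≥1 : ∀ {N} → Pol N → Pol N
  Hom≥1 [] = []
  Hom≥1 ((c , e) ∷ p) with isConstMon e
  ... | true  = Hom≥1 p
  ... | false = (c , e) ∷ Hom≥1 p

  -- R(β X_1, ..., β X_N)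
  scaleVars : ∀ {N} → Carrier → Pol N → Pol N
  scaleVars β p = map (λ t → (proj₁ t * (β ^F mdeg (proj₂ t)) , proj₂ t)) p

  IsSibling : ∀ {N} → Pol N → Pol N → Set (a ⊔ ℓ)
  IsSibling S R = Σ Carrier λ β → (¬ (β ≈ 0#)) × (S ≋ scaleVars β R)

  -- Level 6/5 (ΣΠ): the input of a ∧ gate is an arbitrary polynomial given
  --   as a sum of (weighted) products of variables, i.e. an element of Pol N.
  -- Level 4 (∧):   a pair (e , R) computing R^e.
  -- Level 3 (Σ):   a weighted list of ∧ gates.
  -- Level 2 (Π):   a list of level-3 gates (its length is the fan-in).
  -- Level 1 (Σ):   a weighted list of level-2 gates (its length is the top fan-in).

  PowGate : ℕ → Set a
  PowGate N = ℕ × Pol N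

  SumGate3 : ℕ → Set a
  SumGate3 N = List (Carrier × PowGate N)

  ProdGate2 : ℕ → Set a
  ProdGate2 N = List (SumGate3 N)

  Circuit : ℕ → Set a
  Circuit N = List (Carrier × ProdGate2 N)

  evalPow : ∀ {N} → PowGate N → Pol N
  evalPow (e , R) = R ^P e

  evalSum3 : ∀ {N} → SumGate3 N → Pol N
  evalSum3 g = sumP (map (λ t → proj₁ t ·P evalPow (proj₂ t)) g)

  evalProd2 : ∀ {N} → ProdGate2 N → Pol N
  evalProd2 g = prodP (map evalSum3 g)

  eval : ∀ {N} → Circuit N → Pol N
  eval C = sumP (map (λ t → proj₁ t ·P evalProd2 (proj₂ t)) C)

  topFanIn : ∀ {N} → Circuit N → ℕ
  topFanIn = length

  powInputs : ∀ {N} → Circuit N → List (Pol N)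
  powInputs C = concatMap (λ t → concatMap (λ g → map (λ u → proj₂ (proj₂ u)) g) (proj₂ t)) C

  Level2FanInAtMost : ∀ {N} → ℕ → Circuit N → Set a
  Level2FanInAtMost n C = All (λ t → length (proj₂ t) ℕ.≤ n) C

module Submission where

-- Fix i and write Qⱼ = cⱼ + Rⱼ.  Let Z be the set of j with cⱼ = 0 and z = |Z|;
-- then Πⱼ Qⱼ = (Π_{j∈Z} Rⱼ) · Π_{j∉Z} (1 + Rⱼ).  Since every Rⱼ has no constant
-- term, the degree-n part vanishes when z > n.  Otherwise take a univariate
-- truncated logarithm lg (lg(0) = 0 and exp(lg(Y)) ≡ 1 + Y modulo degree > n) and
-- put L = Σ_{j∉Z} lg(Rⱼ).  Then Π_{j∉Z} (1 + Rⱼ) ≡ Σ_{k≤n} L^k/k! modulo degree > n,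
-- so the degree-n part of Πⱼ Qⱼ is Σ_{k ≤ n-z} (1/k!) · Hom_n((Π_{j∈Z} Rⱼ) · L^k).
-- The product inside has z + k ≤ n factors, and each factor, truncated to degree
-- ≤ n, is a single Σ∧ gate: homogeneous components are extracted by interpolation
-- over the scalings X ↦ 2^t X (this is where characteristic zero is used), and
-- scaling the variables of a power of Rⱼ yields a power of a sibling of Rⱼ.  The
-- outer Hom_n is extracted in the same way at ≤ n²+2 scalings, giving top fan-in
-- ≤ (n+1)(n²+2) per summand.

open import Defs
open import Level using (Level)
import Level
open import Algebra.Bundles using (CommutativeRing)
open import Algebra.Structures using (IsCommutativeRing)
import Algebra.Properties.CommutativeSemiring.Binomial as Binomial
import Algebra.Definitions.RawMonoid as RawMonoid
open import Data.Bool using (Bool; true; false; not)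
open import Data.Nat as ℕ using (ℕ; zero; suc; _≤_; _<_; _∸_; _⊔_; _!)
import Data.Nat.Properties as ℕP
open import Algebra.Properties.CommutativeSemigroup ℕP.+-commutativeSemigroup using () renaming (interchange to ℕ+-interchange)
open import Data.Nat.Combinatorics using (_C_; nCk≡n!/k![n-k]!; k![n∸k]!∣n!)
open import Data.Nat.DivMod using (m/n*n≡m)
open import Data.Fin using (Fin; toℕ)
open import Data.List as List using (List; []; _∷_; _++_; map; concatMap; length; downFrom)
import Data.List.Properties as LP
open import Data.List.Relation.Unary.All as All using (All; []; _∷_)
import Data.List.Relation.Unary.All.Properties as AllP
open import Data.List.Membership.Propositional using (_∈_)
open import Data.Vec as Vec using (zipWith; replicate)
open import Data.Vec.Properties using (≡-dec; ∷-injectiveˡ; ∷-injectiveʳ)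
open import Data.Nat.Properties using () renaming (_≟_ to _≟ℕ_)
open import Data.Product using (Σ; _×_; _,_; proj₁; proj₂)
open import Data.Sum using (_⊎_; inj₁; inj₂; [_,_]′)
open import Relation.Nullary using (¬_; yes; no; Dec)
open import Relation.Nullary.Negation using (contradiction)
open import Relation.Unary using (Decidable)
open import Relation.Binary.Definitions using (tri<; tri≈; tri>)
open import Relation.Binary.PropositionalEquality as Eq using (_≡_; _≢_)

module FiniteSums {c l} (R : CommutativeRing c l) where
  open CommutativeRing R
  open import Relation.Binary.Reasoning.Setoid setoid
  open import Algebra.Properties.Monoid.Sum +-monoid using (sum)
  open import Algebra.Properties.CommutativeSemigroup +-commutativeSemigroup using () renaming (interchange to +-interchange)

  sumN : ℕ → (ℕ → Carrier) → Carrier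
  sumN zero f = 0#
  sumN (suc n) f = sumN n f + f n

  sumN-cong : ∀ n {f g : ℕ → Carrier} → (∀ i → i < n → f i ≈ g i) → sumN n f ≈ sumN n g
  sumN-cong zero h = refl
  sumN-cong (suc n) h = +-cong (sumN-cong n (λ i i<n → h i (ℕP.m<n⇒m<1+n i<n))) (h n (ℕP.n<1+n n))

  sumN-0 : ∀ n (f : ℕ → Carrier) → (∀ i → i < n → f i ≈ 0#) → sumN n f ≈ 0#
  sumN-0 zero f h = refl
  sumN-0 (suc n) f h =
    trans (+-cong (sumN-0 n f (λ i i<n → h i (ℕP.m<n⇒m<1+n i<n))) (h n (ℕP.n<1+n n))) (+-identityʳ 0#)

  sumN-+ : ∀ n (f g : ℕ → Carrier) → sumN n (λ i → f i + g i) ≈ sumN n f + sumN n g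
  sumN-+ zero f g = sym (+-identityˡ _)
  sumN-+ (suc n) f g = trans (+-congʳ (sumN-+ n f g)) (+-interchange _ _ _ _)

  sumN-*ˡ : ∀ n x (f : ℕ → Carrier) → x * sumN n f ≈ sumN n (λ i → x * f i)
  sumN-*ˡ zero x f = zeroʳ x
  sumN-*ˡ (suc n) x f = trans (distribˡ x _ _) (+-congʳ (sumN-*ˡ n x f))

  sumN-*ʳ : ∀ n x (f : ℕ → Carrier) → sumN n f * x ≈ sumN n (λ i → f i * x)
  sumN-*ʳ n x f = trans (*-comm _ _) (trans (sumN-*ˡ n x f) (sumN-cong n (λ i _ → *-comm _ _)))

  sumN-front : ∀ n (f : ℕ → Carrier) → sumN (suc n) f ≈ f 0 + sumN n (λ i → f (suc i))
  sumN-front zero f = trans (+-identityˡ _) (sym (+-identityʳ _))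
  sumN-front (suc n) f = trans (+-congʳ (sumN-front n f)) (+-assoc _ _ _)

  sumN-split : ∀ a b (f : ℕ → Carrier) → sumN (a ℕ.+ b) f ≈ sumN a f + sumN b (λ j → f (a ℕ.+ j))
  sumN-split a zero f = trans (reflexive (Eq.cong (λ z → sumN z f) (ℕP.+-identityʳ a))) (sym (+-identityʳ _))
  sumN-split a (suc b) f = begin
    sumN (a ℕ.+ suc b) f                            ≡⟨ Eq.cong (λ z → sumN z f) (ℕP.+-suc a b) ⟩
    sumN (a ℕ.+ b) f + f (a ℕ.+ b)                  ≈⟨ +-congʳ (sumN-split a b f) ⟩
    (sumN a f + sumN b (λ j → f (a ℕ.+ j))) + f (a ℕ.+ b) ≈⟨ +-assoc _ _ _ ⟩
    sumN a f + sumN (suc b) (λ j → f (a ℕ.+ j))     ∎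

  sumN-prod : ∀ n n' (f g : ℕ → Carrier) → sumN n f * sumN n' g ≈ sumN n (λ i → sumN n' (λ j → f i * g j))
  sumN-prod n n' f g = trans (sumN-*ʳ n (sumN n' g) f) (sumN-cong n (λ i _ → sumN-*ˡ n' (f i) g))

  sumN-fin : ∀ n (h : ℕ → Carrier) → sum {n} (λ i → h (toℕ i)) ≈ sumN n h
  sumN-fin zero h = refl
  sumN-fin (suc n) h = trans (+-congˡ (sumN-fin n (λ i → h (suc i)))) (sym (sumN-front n h))

  triangle : ∀ n (X : ℕ → ℕ → Carrier) →
    sumN (suc n) (λ m → sumN (suc m) (λ k → X k (m ∸ k))) ≈ sumN (suc n) (λ i → sumN (suc (n ∸ i)) (λ j → X i j))
  triangle zero X = refl
  triangle (suc n) X = begin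
    sumN (suc n) diag + newDiag                                 ≈⟨ +-congʳ (triangle n X) ⟩
    sumN (suc n) row + newDiag                                  ≈⟨ sym (+-assoc _ _ _) ⟩
    (sumN (suc n) row + sumN (suc n) (λ k → X k (suc n ∸ k))) + X (suc n) (suc n ∸ suc n)
                                                                ≈⟨ +-congʳ (sym (sumN-+ (suc n) row _)) ⟩
    sumN (suc n) (λ i → row i + X i (suc n ∸ i)) + X (suc n) (suc n ∸ suc n)
                                                                ≈⟨ +-cong (sumN-cong (suc n) extendRow) lastRow ⟩
    sumN (suc n) row' + row' (suc n)                            ∎
    where
    diag = λ m → sumN (suc m) (λ k → X k (m ∸ k))
    newDiag = sumN (suc (suc n)) (λ k → X k (suc n ∸ k))
    row = λ i → sumN (suc (n ∸ i)) (λ j → X i j)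
    row' = λ i → sumN (suc (suc n ∸ i)) (λ j → X i j)
    extendRow : ∀ i → i < suc n → row i + X i (suc n ∸ i) ≈ row' i
    extendRow i i<sn = reflexive (Eq.trans (Eq.cong (λ z → row i + X i z) e) (Eq.cong (λ z → sumN (suc z) (X i)) (Eq.sym e)))
      where
      e : suc n ∸ i ≡ suc (n ∸ i)
      e = ℕP.+-∸-assoc 1 (ℕP.≤-pred i<sn)
    lastRow : X (suc n) (suc n ∸ suc n) ≈ row' (suc n)
    lastRow = begin
      X (suc n) (suc n ∸ suc n) ≡⟨ Eq.cong (X (suc n)) (ℕP.n∸n≡0 (suc n)) ⟩
      X (suc n) 0               ≈⟨ sym (+-identityˡ _) ⟩
      0# + X (suc n) 0          ≡⟨ Eq.cong (λ z → sumN (suc z) (X (suc n))) (Eq.sym (ℕP.n∸n≡0 (suc n))) ⟩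
      row' (suc n)              ∎

  sumL : ∀ {b} {X : Set b} → List X → (X → Carrier) → Carrier
  sumL [] f = 0#
  sumL (x ∷ xs) f = f x + sumL xs f

  module _ {b} {X : Set b} where
    sumL-cong : (xs : List X) {f g : X → Carrier} → (∀ x → f x ≈ g x) → sumL xs f ≈ sumL xs g
    sumL-cong [] h = refl
    sumL-cong (x ∷ xs) h = +-cong (h x) (sumL-cong xs h)

    sumL-congAll : ∀ {p} {P : X → Set p} (xs : List X) {f g : X → Carrier} →
      All P xs → (∀ x → P x → f x ≈ g x) → sumL xs f ≈ sumL xs g
    sumL-congAll [] [] h = refl
    sumL-congAll (x ∷ xs) (px ∷ pxs) h = +-cong (h x px) (sumL-congAll xs pxs h)

    sumL-++ : (xs ys : List X) (f : X → Carrier) → sumL (xs ++ ys) f ≈ sumL xs f + sumL ys f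
    sumL-++ [] ys f = sym (+-identityˡ _)
    sumL-++ (x ∷ xs) ys f = trans (+-congˡ (sumL-++ xs ys f)) (sym (+-assoc _ _ _))

    sumL-+ : (xs : List X) (f g : X → Carrier) → sumL xs (λ x → f x + g x) ≈ sumL xs f + sumL xs g
    sumL-+ [] f g = sym (+-identityˡ _)
    sumL-+ (x ∷ xs) f g = trans (+-congˡ (sumL-+ xs f g)) (+-interchange _ _ _ _)

    sumL-*ˡ : (xs : List X) (c : Carrier) (f : X → Carrier) → c * sumL xs f ≈ sumL xs (λ x → c * f x)
    sumL-*ˡ [] c f = zeroʳ c
    sumL-*ˡ (x ∷ xs) c f = trans (distribˡ c _ _) (+-congˡ (sumL-*ˡ xs c f))

    sumL-*ʳ : (xs : List X) (c : Carrier) (f : X → Carrier) → sumL xs f * c ≈ sumL xs (λ x → f x * c)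
    sumL-*ʳ xs c f = trans (*-comm _ _) (trans (sumL-*ˡ xs c f) (sumL-cong xs (λ x → *-comm _ _)))

    sumL-0 : (xs : List X) (f : X → Carrier) → (∀ x → f x ≈ 0#) → sumL xs f ≈ 0#
    sumL-0 [] f h = refl
    sumL-0 (x ∷ xs) f h = trans (+-cong (h x) (sumL-0 xs f h)) (+-identityˡ 0#)

  sumL-map : ∀ {b c} {X : Set b} {Y : Set c} (xs : List X) (h : X → Y) (f : Y → Carrier) →
    sumL (map h xs) f ≈ sumL xs (λ x → f (h x))
  sumL-map [] h f = refl
  sumL-map (x ∷ xs) h f = +-congˡ (sumL-map xs h f)

  sumL-concatMap : ∀ {b c} {X : Set b} {Y : Set c} (xs : List X) (h : X → List Y) (f : Y → Carrier) →
    sumL (concatMap h xs) f ≈ sumL xs (λ x → sumL (h x) f)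
  sumL-concatMap [] h f = refl
  sumL-concatMap (x ∷ xs) h f = trans (sumL-++ (h x) (concatMap h xs) f) (+-congˡ (sumL-concatMap xs h f))

  sumL-swap : ∀ {b c} {X : Set b} {Y : Set c} (xs : List X) (ys : List Y) (f : X → Y → Carrier) →
    sumL xs (λ x → sumL ys (λ y → f x y)) ≈ sumL ys (λ y → sumL xs (λ x → f x y))
  sumL-swap [] ys f = sym (sumL-0 ys _ (λ _ → refl))
  sumL-swap (x ∷ xs) ys f = trans (+-congˡ (sumL-swap xs ys f)) (sym (sumL-+ ys (f x) _))

  sumL-downFrom : ∀ k (f : ℕ → Carrier) → sumL (downFrom k) f ≈ sumN k f
  sumL-downFrom zero f = refl
  sumL-downFrom (suc k) f = trans (+-congˡ (sumL-downFrom k f)) (+-comm _ _)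

-- The numeric bound on the top fan-in: each of the T products contributes at most
-- (n+1)(n²+2) ≤ 8n³ multiplication gates, and 8 ≤ 2^(3k) as soon as k ≥ 1.
module FanInArithmetic where
  open import Data.Nat.Solver using (module +-*-Solver)
  open +-*-Solver
  open ℕP.≤-Reasoning

  perProduct≤8n³ : ∀ n → 1 ≤ n → suc n ℕ.* suc (suc (n ℕ.* n)) ≤ 8 ℕ.* (n ℕ.^ 3)
  perProduct≤8n³ n 1≤n = begin
    suc n ℕ.* suc (suc (n ℕ.* n))                   ≤⟨ ℕP.*-mono-≤ (ℕP.+-monoˡ-≤ n 1≤n) (ℕP.+-monoˡ-≤ (n ℕ.* n) (ℕP.+-mono-≤ 1≤n² 1≤n²)) ⟩
    (n ℕ.+ n) ℕ.* ((n ℕ.* n ℕ.+ n ℕ.* n) ℕ.+ n ℕ.* n) ≡⟨ six n ⟩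
    6 ℕ.* (n ℕ.^ 3)                                  ≤⟨ ℕP.*-monoˡ-≤ (n ℕ.^ 3) (ℕP.+-monoʳ-≤ 6 (ℕ.z≤n {2})) ⟩
    8 ℕ.* (n ℕ.^ 3)                                  ∎
    where
    1≤n² : 1 ≤ n ℕ.* n
    1≤n² = ℕP.*-mono-≤ 1≤n 1≤n
    six : ∀ n → (n ℕ.+ n) ℕ.* ((n ℕ.* n ℕ.+ n ℕ.* n) ℕ.+ n ℕ.* n) ≡ 6 ℕ.* (n ℕ.^ 3)
    six = solve 1 (λ n → (n :+ n) :* ((n :* n :+ n :* n) :+ n :* n) := con 6 :* (n :* (n :* (n :* con 1)))) Eq.refl

  topFanInBound : ∀ T d n k → 1 ≤ d → 1 ≤ n → n ≤ k ℕ.* k →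
    T ℕ.* (suc n ℕ.* suc (suc (n ℕ.* n))) ≤ T ℕ.* (d ℕ.^ 2) ℕ.* (n ℕ.^ 3) ℕ.* (2 ℕ.^ (3 ℕ.* k))
  topFanInBound T d n zero 1≤d 1≤n n≤k² = contradiction (ℕP.≤-trans 1≤n n≤k²) (λ ())
  topFanInBound T d n (suc k) 1≤d 1≤n n≤k² = begin
    T ℕ.* (suc n ℕ.* suc (suc (n ℕ.* n))) ≤⟨ ℕP.*-monoʳ-≤ T (perProduct≤8n³ n 1≤n) ⟩
    T ℕ.* (8 ℕ.* n³)                      ≤⟨ ℕP.*-monoʳ-≤ T (ℕP.*-mono-≤ 8≤d²2^3k (ℕP.≤-refl {n³})) ⟩
    T ℕ.* ((d ℕ.^ 2 ℕ.* w) ℕ.* n³)        ≡⟨ reassoc T (d ℕ.^ 2) n³ w ⟩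
    T ℕ.* (d ℕ.^ 2) ℕ.* n³ ℕ.* w          ∎
    where
    n³ = n ℕ.^ 3
    w = 2 ℕ.^ (3 ℕ.* suc k)
    8≤d²2^3k : 8 ≤ d ℕ.^ 2 ℕ.* w
    8≤d²2^3k = ℕP.*-mono-≤ (ℕP.*-mono-≤ 1≤d (ℕP.*-mono-≤ 1≤d (ℕP.≤-refl {1})))
                            (ℕP.^-monoʳ-≤ 2 {3} {3 ℕ.* suc k} (ℕP.*-monoʳ-≤ 3 (ℕ.s≤s ℕ.z≤n)))
    reassoc : ∀ T e m w → T ℕ.* ((e ℕ.* w) ℕ.* m) ≡ T ℕ.* e ℕ.* m ℕ.* w
    reassoc = solve 4 (λ T e m w → T :* ((e :* w) :* m) := T :* e :* m :* w) Eq.refl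

module Construction {a ℓ} (F : CharZeroField a ℓ) where
  open Poly F hiding (zero)
  open import Relation.Binary.Reasoning.Setoid setoid
  module FieldSum = FiniteSums commutativeRing
  open FieldSum using (sumL; sumL-cong; sumL-congAll; sumL-++; sumL-+; sumL-*ˡ; sumL-*ʳ; sumL-0; sumL-map; sumL-concatMap; sumL-swap)
  open import Algebra.Properties.CommutativeSemigroup +-commutativeSemigroup using () renaming (interchange to +-interchange)
  open import Algebra.Properties.CommutativeSemigroup *-commutativeSemigroup using ()
    renaming (interchange to *-interchange; x∙yz≈y∙xz to *-leftSwap)
  open import Algebra.Properties.Ring ring using (-1*x≈-x)
  import Algebra.Solver.Ring.NaturalCoefficients.Default as NaturalSolver
  module Solver = NaturalSolver commutativeSemiring
  open import Algebra.Properties.Group +-group using (x∙y⁻¹≈ε⇒x≈y; x≈y⇒x∙y⁻¹≈ε; loop)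
  open import Algebra.Properties.Loop loop using (identityʳ-unique)

  infixl 6 _+v_
  _+v_ : ∀ {N} → Monomial N → Monomial N → Monomial N
  _+v_ = zipWith ℕ._+_

  _-v_ : ∀ {N} → Monomial N → Monomial N → Monomial N
  _-v_ = zipWith ℕ._∸_

  0v : ∀ {N} → Monomial N
  0v = replicate _ 0

  v-comm : ∀ {N} (e f : Monomial N) → e +v f ≡ f +v e
  v-comm Vec.[] Vec.[] = Eq.refl
  v-comm (x Vec.∷ e) (y Vec.∷ f) = Eq.cong₂ Vec._∷_ (ℕP.+-comm x y) (v-comm e f)

  v-assoc : ∀ {N} (e f g : Monomial N) → (e +v f) +v g ≡ e +v (f +v g)
  v-assoc Vec.[] Vec.[] Vec.[] = Eq.refl
  v-assoc (x Vec.∷ e) (y Vec.∷ f) (z Vec.∷ g) = Eq.cong₂ Vec._∷_ (ℕP.+-assoc x y z) (v-assoc e f g)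

  v-idˡ : ∀ {N} (e : Monomial N) → 0v +v e ≡ e
  v-idˡ Vec.[] = Eq.refl
  v-idˡ (x Vec.∷ e) = Eq.cong (x Vec.∷_) (v-idˡ e)

  v-sub : ∀ {N} (e u m : Monomial N) → e +v u ≡ m → e ≡ m -v u
  v-sub Vec.[] Vec.[] Vec.[] h = Eq.refl
  v-sub (x Vec.∷ e) (y Vec.∷ u) (z Vec.∷ m) h =
    Eq.cong₂ Vec._∷_ (Eq.trans (Eq.sym (ℕP.m+n∸n≡m x y)) (Eq.cong (ℕ._∸ y) (∷-injectiveˡ h)))
                      (v-sub e u m (∷-injectiveʳ h))

  mdeg-+ : ∀ {N} (e f : Monomial N) → mdeg (e +v f) ≡ mdeg e ℕ.+ mdeg f
  mdeg-+ Vec.[] Vec.[] = Eq.refl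
  mdeg-+ (x Vec.∷ e) (y Vec.∷ f) =
    Eq.trans (Eq.cong (x ℕ.+ y ℕ.+_) (mdeg-+ e f)) (ℕ+-interchange x y (mdeg e) (mdeg f))

  mdeg-0 : ∀ {N} → mdeg (0v {N}) ≡ 0
  mdeg-0 {zero} = Eq.refl
  mdeg-0 {suc N} = mdeg-0 {N}

  Term : ℕ → Set a
  Term N = Carrier × Monomial N

  mulTerm : ∀ {N} → Term N → Term N → Term N
  mulTerm t u = (proj₁ t * proj₁ u , proj₂ t +v proj₂ u)

  coeffT : ∀ {N} → Term N → Monomial N → Carrier
  coeffT t m = coeff (t ∷ []) m

  coeffT-yes : ∀ {N} c (e m : Monomial N) → e ≡ m → coeffT (c , e) m ≈ c
  coeffT-yes c e m eq with ≡-dec _≟ℕ_ e m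
  ... | yes _ = +-identityʳ c
  ... | no ne = contradiction eq ne

  coeffT-no : ∀ {N} c (e m : Monomial N) → e ≢ m → coeffT (c , e) m ≈ 0#
  coeffT-no c e m ne with ≡-dec _≟ℕ_ e m
  ... | yes eq = contradiction eq ne
  ... | no _ = refl

  coeffT-cong : ∀ {N} {c c'} (e m : Monomial N) → c ≈ c' → coeffT (c , e) m ≈ coeffT (c' , e) m
  coeffT-cong e m h with ≡-dec _≟ℕ_ e m
  ... | yes _ = +-congʳ h
  ... | no _ = refl

  coeffT-≡ : ∀ {N} c {e e' : Monomial N} m → e ≡ e' → coeffT (c , e) m ≈ coeffT (c , e') m
  coeffT-≡ c m Eq.refl = refl

  coeffT-* : ∀ {N} k c (e m : Monomial N) → coeffT (k * c , e) m ≈ k * coeffT (c , e) m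
  coeffT-* k c e m with ≡-dec _≟ℕ_ e m
  ... | yes _ = trans (+-identityʳ _) (*-congˡ (sym (+-identityʳ c)))
  ... | no _ = sym (zeroʳ k)

  coeff-∷ : ∀ {N} (t : Term N) p m → coeff (t ∷ p) m ≈ coeffT t m + coeff p m
  coeff-∷ (c , e) p m with ≡-dec _≟ℕ_ e m
  ... | yes _ = +-congʳ (sym (+-identityʳ c))
  ... | no _ = sym (+-identityˡ _)

  coeff-sumL : ∀ {N} (p : Pol N) m → coeff p m ≈ sumL p (λ t → coeffT t m)
  coeff-sumL [] m = refl
  coeff-sumL (t ∷ p) m = trans (coeff-∷ t p m) (+-congˡ (coeff-sumL p m))

  coeff-++ : ∀ {N} (p q : Pol N) m → coeff (p ++ q) m ≈ coeff p m + coeff q m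
  coeff-++ p q m = trans (coeff-sumL (p ++ q) m) (trans (sumL-++ p q _) (sym (+-cong (coeff-sumL p m) (coeff-sumL q m))))

  coeff-· : ∀ {N} k (p : Pol N) m → coeff (k ·P p) m ≈ k * coeff p m
  coeff-· k p m = begin
    coeff (k ·P p) m                                  ≈⟨ coeff-sumL (k ·P p) m ⟩
    sumL (k ·P p) (λ t → coeffT t m)                  ≈⟨ sumL-map p _ _ ⟩
    sumL p (λ t → coeffT (k * proj₁ t , proj₂ t) m)   ≈⟨ sumL-cong p (λ t → coeffT-* k (proj₁ t) (proj₂ t) m) ⟩
    sumL p (λ t → k * coeffT t m)                     ≈⟨ sym (sumL-*ˡ p k _) ⟩
    k * sumL p (λ t → coeffT t m)                     ≈⟨ *-congˡ (sym (coeff-sumL p m)) ⟩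
    k * coeff p m                                     ∎

  coeff-* : ∀ {N} (p q : Pol N) m → coeff (p *P q) m ≈ sumL p (λ t → sumL q (λ u → coeffT (mulTerm t u) m))
  coeff-* p q m = begin
    coeff (p *P q) m                                             ≈⟨ coeff-sumL (p *P q) m ⟩
    sumL (p *P q) (λ t → coeffT t m)                             ≈⟨ sumL-concatMap p _ _ ⟩
    sumL p (λ t → sumL (map (mulTerm t) q) (λ v → coeffT v m))   ≈⟨ sumL-cong p (λ t → sumL-map q (mulTerm t) _) ⟩
    sumL p (λ t → sumL q (λ u → coeffT (mulTerm t u) m))         ∎

  coeffT-mulTerm-shift : ∀ {N} (t u : Term N) m → (m -v proj₂ u) +v proj₂ u ≡ m →
    coeffT (mulTerm t u) m ≈ coeffT t (m -v proj₂ u) * proj₁ u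
  coeffT-mulTerm-shift (c , e) (d , f) m h with ≡-dec _≟ℕ_ (e +v f) m | ≡-dec _≟ℕ_ e (m -v f)
  ... | yes _ | yes _ = trans (+-identityʳ _) (*-congʳ (sym (+-identityʳ c)))
  ... | yes q | no ne = contradiction (v-sub e f m q) ne
  ... | no ne | yes q = contradiction (Eq.trans (Eq.cong (_+v f) q) h) ne
  ... | no _ | no _ = sym (zeroˡ d)

  coeffT-mulTerm-noShift : ∀ {N} (t u : Term N) m → (m -v proj₂ u) +v proj₂ u ≢ m → coeffT (mulTerm t u) m ≈ 0#
  coeffT-mulTerm-noShift (c , e) (d , f) m h = coeffT-no _ _ _ (λ q → h (Eq.subst (λ z → z +v f ≡ m) (v-sub e f m q) q))

  -- Hence multiplying by a fixed term u respects equality of polynomials; this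
  -- is the key step in showing that _*P_ is a congruence.
  shift-cong : ∀ {N} (p p' : Pol N) → p ≋ p' → ∀ u m →
    sumL p (λ t → coeffT (mulTerm t u) m) ≈ sumL p' (λ t → coeffT (mulTerm t u) m)
  shift-cong p p' h u m with ≡-dec _≟ℕ_ ((m -v proj₂ u) +v proj₂ u) m
  ... | no ne = trans (sumL-0 p _ (λ t → coeffT-mulTerm-noShift t u m ne)) (sym (sumL-0 p' _ (λ t → coeffT-mulTerm-noShift t u m ne)))
  ... | yes q = begin
    sumL p (λ t → coeffT (mulTerm t u) m)   ≈⟨ sumL-cong p (λ t → coeffT-mulTerm-shift t u m q) ⟩
    sumL p (λ t → coeffT t v * proj₁ u)     ≈⟨ sym (sumL-*ʳ p _ _) ⟩
    sumL p (λ t → coeffT t v) * proj₁ u     ≈⟨ *-congʳ (trans (sym (coeff-sumL p v)) (trans (h v) (coeff-sumL p' v))) ⟩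
    sumL p' (λ t → coeffT t v) * proj₁ u    ≈⟨ sumL-*ʳ p' _ _ ⟩
    sumL p' (λ t → coeffT t v * proj₁ u)    ≈⟨ sym (sumL-cong p' (λ t → coeffT-mulTerm-shift t u m q)) ⟩
    sumL p' (λ t → coeffT (mulTerm t u) m)  ∎
    where v = m -v proj₂ u

  -- Equality of polynomials, packaged as a record so that Agda can infer the two
  -- polynomials from a proof (the function type _≋_ hides them under coeff).
  infix 4 _≐_
  record _≐_ {N} (p q : Pol N) : Set ℓ where
    constructor coeffwise
    field coeff≈ : p ≋ q
  open _≐_ public

  module _ {N : ℕ} where
    ≐-refl : {p : Pol N} → p ≐ p
    ≐-refl = coeffwise (λ m → refl)

    ≐-sym : {p q : Pol N} → p ≐ q → q ≐ p
    ≐-sym h = coeffwise (λ m → sym (coeff≈ h m))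

    ≐-trans : {p q r : Pol N} → p ≐ q → q ≐ r → p ≐ r
    ≐-trans h g = coeffwise (λ m → trans (coeff≈ h m) (coeff≈ g m))

    ≐-reflexive : {p q : Pol N} → p ≡ q → p ≐ q
    ≐-reflexive Eq.refl = ≐-refl

  infix 1 beginP_
  infixr 2 _≐⟨_⟩_ _≐˘⟨_⟩_
  infix 3 _∎P

  beginP_ : ∀ {N} {p q : Pol N} → p ≐ q → p ≐ q
  beginP h = h

  _≐⟨_⟩_ : ∀ {N} (p : Pol N) {q r : Pol N} → p ≐ q → q ≐ r → p ≐ r
  p ≐⟨ h ⟩ g = ≐-trans h g

  _≐˘⟨_⟩_ : ∀ {N} (p : Pol N) {q r : Pol N} → q ≐ p → q ≐ r → p ≐ r
  p ≐˘⟨ h ⟩ g = ≐-trans (≐-sym h) g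

  _∎P : ∀ {N} (p : Pol N) → p ≐ p
  p ∎P = ≐-refl

  negP : ∀ {N} → Pol N → Pol N
  negP p = (- 1#) ·P p

  coeff-difference : ∀ {N} (p q : Pol N) m → coeff (p +P negP q) m ≈ coeff p m - coeff q m
  coeff-difference p q m = trans (coeff-++ p (negP q) m) (+-congˡ (trans (coeff-· (- 1#) q m) (-1*x≈-x _)))

  module _ {N : ℕ} where
    +P-cong : {p p' q q' : Pol N} → p ≐ p' → q ≐ q' → p +P q ≐ p' +P q'
    +P-cong {p} {p'} {q} {q'} h g = coeffwise λ m →
      trans (coeff-++ p q m) (trans (+-cong (coeff≈ h m) (coeff≈ g m)) (sym (coeff-++ p' q' m)))

    +P-assoc : (p q r : Pol N) → (p +P q) +P r ≐ p +P (q +P r)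
    +P-assoc p q r = coeffwise λ m → begin
      coeff ((p ++ q) ++ r) m             ≈⟨ coeff-++ (p ++ q) r m ⟩
      coeff (p ++ q) m + coeff r m        ≈⟨ +-congʳ (coeff-++ p q m) ⟩
      (coeff p m + coeff q m) + coeff r m ≈⟨ +-assoc _ _ _ ⟩
      coeff p m + (coeff q m + coeff r m) ≈⟨ +-congˡ (sym (coeff-++ q r m)) ⟩
      coeff p m + coeff (q ++ r) m        ≈⟨ sym (coeff-++ p (q ++ r) m) ⟩
      coeff (p ++ (q ++ r)) m             ∎

    +P-comm : (p q : Pol N) → p +P q ≐ q +P p
    +P-comm p q = coeffwise λ m → trans (coeff-++ p q m) (trans (+-comm _ _) (sym (coeff-++ q p m)))

    +P-idʳ : (p : Pol N) → p +P [] ≐ p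
    +P-idʳ p = coeffwise λ m → trans (coeff-++ p [] m) (+-identityʳ _)

    negP-inv : (p : Pol N) → negP p +P p ≐ []
    negP-inv p = coeffwise λ m →
      trans (coeff-++ (negP p) p m) (trans (+-congʳ (trans (coeff-· (- 1#) p m) (-1*x≈-x _))) (-‿inverseˡ _))

    ·P-cong : ∀ k {p q : Pol N} → p ≐ q → k ·P p ≐ k ·P q
    ·P-cong k {p} {q} h = coeffwise λ m → trans (coeff-· k p m) (trans (*-congˡ (coeff≈ h m)) (sym (coeff-· k q m)))

    *P-comm : (p q : Pol N) → p *P q ≐ q *P p
    *P-comm p q = coeffwise λ m → begin
      coeff (p *P q) m                                         ≈⟨ coeff-* p q m ⟩
      sumL p (λ t → sumL q (λ u → coeffT (mulTerm t u) m))     ≈⟨ sumL-swap p q _ ⟩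
      sumL q (λ u → sumL p (λ t → coeffT (mulTerm t u) m))     ≈⟨ sumL-cong q (λ u → sumL-cong p (λ t → mulTerm-comm t u m)) ⟩
      sumL q (λ u → sumL p (λ t → coeffT (mulTerm u t) m))     ≈⟨ sym (coeff-* q p m) ⟩
      coeff (q *P p) m                                         ∎
      where
      mulTerm-comm : ∀ t u m → coeffT (mulTerm t u) m ≈ coeffT (mulTerm u t) m
      mulTerm-comm t u m = trans (coeffT-cong (proj₂ t +v proj₂ u) m (*-comm (proj₁ t) (proj₁ u)))
                                 (coeffT-≡ _ m (v-comm (proj₂ t) (proj₂ u)))

    *P-congʳ : {p p' : Pol N} (q : Pol N) → p ≐ p' → p *P q ≐ p' *P q
    *P-congʳ {p} {p'} q h = coeffwise λ m → begin
      coeff (p *P q) m                                       ≈⟨ coeff-* p q m ⟩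
      sumL p (λ t → sumL q (λ u → coeffT (mulTerm t u) m))   ≈⟨ sumL-swap p q _ ⟩
      sumL q (λ u → sumL p (λ t → coeffT (mulTerm t u) m))   ≈⟨ sumL-cong q (λ u → shift-cong p p' (coeff≈ h) u m) ⟩
      sumL q (λ u → sumL p' (λ t → coeffT (mulTerm t u) m))  ≈⟨ sym (sumL-swap p' q _) ⟩
      sumL p' (λ t → sumL q (λ u → coeffT (mulTerm t u) m))  ≈⟨ sym (coeff-* p' q m) ⟩
      coeff (p' *P q) m                                      ∎

    *P-cong : {p p' q q' : Pol N} → p ≐ p' → q ≐ q' → p *P q ≐ p' *P q'
    *P-cong {p} {p'} {q} {q'} h g = beginP
      p *P q   ≐⟨ *P-congʳ q h ⟩
      p' *P q  ≐⟨ *P-comm p' q ⟩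
      q *P p'  ≐⟨ *P-congʳ p' g ⟩
      q' *P p' ≐⟨ *P-comm q' p' ⟩
      p' *P q' ∎P

    *P-assoc : (p q r : Pol N) → (p *P q) *P r ≐ p *P (q *P r)
    *P-assoc p q r = coeffwise λ m → begin
      coeff ((p *P q) *P r) m
        ≈⟨ coeff-* (p *P q) r m ⟩
      sumL (p *P q) (λ v → sumL r (λ w → coeffT (mulTerm v w) m))
        ≈⟨ sumL-concatMap p _ _ ⟩
      sumL p (λ t → sumL (map (mulTerm t) q) (λ v → sumL r (λ w → coeffT (mulTerm v w) m)))
        ≈⟨ sumL-cong p (λ t → sumL-map q (mulTerm t) _) ⟩
      sumL p (λ t → sumL q (λ u → sumL r (λ w → coeffT (mulTerm (mulTerm t u) w) m)))
        ≈⟨ sumL-cong p (λ t → sumL-cong q (λ u → sumL-cong r (λ w → mulTerm-assoc t u w m))) ⟩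
      sumL p (λ t → sumL q (λ u → sumL r (λ w → coeffT (mulTerm t (mulTerm u w)) m)))
        ≈⟨ sumL-cong p (λ t → sumL-cong q (λ u → sym (sumL-map r (mulTerm u) _))) ⟩
      sumL p (λ t → sumL q (λ u → sumL (map (mulTerm u) r) (λ v → coeffT (mulTerm t v) m)))
        ≈⟨ sumL-cong p (λ t → sym (sumL-concatMap q (λ u → map (mulTerm u) r) _)) ⟩
      sumL p (λ t → sumL (q *P r) (λ v → coeffT (mulTerm t v) m))
        ≈⟨ sym (coeff-* p (q *P r) m) ⟩
      coeff (p *P (q *P r)) m ∎
      where
      mulTerm-assoc : ∀ t u w m → coeffT (mulTerm (mulTerm t u) w) m ≈ coeffT (mulTerm t (mulTerm u w)) m
      mulTerm-assoc t u w m = trans (coeffT-cong ((proj₂ t +v proj₂ u) +v proj₂ w) m (*-assoc (proj₁ t) (proj₁ u) (proj₁ w)))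
                                    (coeffT-≡ _ m (v-assoc (proj₂ t) (proj₂ u) (proj₂ w)))

    *P-idˡ : (p : Pol N) → constP 1# *P p ≐ p
    *P-idˡ p = coeffwise λ m → begin
      coeff (constP 1# *P p) m                             ≈⟨ coeff-* (constP 1#) p m ⟩
      sumL p (λ u → coeffT (mulTerm (1# , 0v) u) m) + 0#   ≈⟨ +-identityʳ _ ⟩
      sumL p (λ u → coeffT (mulTerm (1# , 0v) u) m)        ≈⟨ sumL-cong p (unit m) ⟩
      sumL p (λ u → coeffT u m)                            ≈⟨ sym (coeff-sumL p m) ⟩
      coeff p m                                            ∎
      where
      unit : ∀ m u → coeffT (mulTerm (1# , 0v) u) m ≈ coeffT u m
      unit m u = trans (coeffT-cong (0v +v proj₂ u) m (*-identityˡ _)) (coeffT-≡ _ m (v-idˡ (proj₂ u)))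

    *P-distribˡ : (p q r : Pol N) → p *P (q +P r) ≐ (p *P q) +P (p *P r)
    *P-distribˡ p q r = coeffwise λ m → begin
      coeff (p *P (q ++ r)) m
        ≈⟨ coeff-* p (q ++ r) m ⟩
      sumL p (λ t → sumL (q ++ r) (λ u → coeffT (mulTerm t u) m))
        ≈⟨ sumL-cong p (λ t → sumL-++ q r _) ⟩
      sumL p (λ t → sumL q (λ u → coeffT (mulTerm t u) m) + sumL r (λ u → coeffT (mulTerm t u) m))
        ≈⟨ sumL-+ p _ _ ⟩
      sumL p (λ t → sumL q (λ u → coeffT (mulTerm t u) m)) + sumL p (λ t → sumL r (λ u → coeffT (mulTerm t u) m))
        ≈⟨ sym (+-cong (coeff-* p q m) (coeff-* p r m)) ⟩
      coeff (p *P q) m + coeff (p *P r) m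
        ≈⟨ sym (coeff-++ (p *P q) (p *P r) m) ⟩
      coeff ((p *P q) ++ (p *P r)) m ∎

    *P-distribʳ : (p q r : Pol N) → (q +P r) *P p ≐ (q *P p) +P (r *P p)
    *P-distribʳ p q r = beginP
      (q +P r) *P p          ≐⟨ *P-comm (q +P r) p ⟩
      p *P (q +P r)          ≐⟨ *P-distribˡ p q r ⟩
      (p *P q) +P (p *P r)   ≐⟨ +P-cong (*P-comm p q) (*P-comm p r) ⟩
      (q *P p) +P (r *P p)   ∎P

    Pol-isCommutativeRing : IsCommutativeRing (_≐_ {N}) _+P_ _*P_ negP [] (constP 1#)
    Pol-isCommutativeRing = record
      { isRing = record
        { +-isAbelianGroup = record
          { isGroup = record
            { isMonoid = record
              { isSemigroup = record
                { isMagma = record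
                  { isEquivalence = record { refl = ≐-refl ; sym = ≐-sym ; trans = ≐-trans }
                  ; ∙-cong = +P-cong }
                ; assoc = +P-assoc }
              ; identity = (λ p → ≐-refl) , +P-idʳ }
            ; inverse = negP-inv , (λ p → ≐-trans (+P-comm p (negP p)) (negP-inv p))
            ; ⁻¹-cong = ·P-cong (- 1#) }
          ; comm = +P-comm }
        ; *-cong = *P-cong
        ; *-assoc = *P-assoc
        ; *-identity = *P-idˡ , (λ p → ≐-trans (*P-comm p (constP 1#)) (*P-idˡ p))
        ; distrib = *P-distribˡ , (λ p q r → *P-distribʳ p q r) }
      ; *-comm = *P-comm }

  PolR : ℕ → CommutativeRing a ℓ
  PolR N = record { isCommutativeRing = Pol-isCommutativeRing {N} }

  module PolySum (N : ℕ) = FiniteSums (PolR N)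

  TermsIn : ∀ {N} → (ℕ → Set) → Pol N → Set a
  TermsIn Q p = All (λ t → Q (mdeg (proj₂ t))) p

  DegreesIn : ∀ {N} → (ℕ → Set) → Pol N → Set ℓ
  DegreesIn Q p = ∀ m → ¬ Q (mdeg m) → coeff p m ≈ 0#

  filterDeg : ∀ {N} {Q : ℕ → Set} → Decidable Q → Pol N → Pol N
  filterDeg Q? [] = []
  filterDeg Q? ((c , e) ∷ p) with Q? (mdeg e)
  ... | yes _ = (c , e) ∷ filterDeg Q? p
  ... | no _ = filterDeg Q? p

  termsIn⇒degreesIn : ∀ {N} {Q : ℕ → Set} (p : Pol N) → TermsIn Q p → DegreesIn Q p
  termsIn⇒degreesIn [] h m nq = refl
  termsIn⇒degreesIn {Q = Q} ((c , e) ∷ p) (qe ∷ h) m nq =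
    trans (coeff-∷ (c , e) p m)
          (trans (+-cong (coeffT-no c e m (λ eq → nq (Eq.subst (λ z → Q (mdeg z)) eq qe))) (termsIn⇒degreesIn {Q = Q} p h m nq))
                 (+-identityˡ 0#))

  filterDeg-terms : ∀ {N} {Q : ℕ → Set} (Q? : Decidable Q) (p : Pol N) → TermsIn Q (filterDeg Q? p)
  filterDeg-terms Q? [] = []
  filterDeg-terms Q? ((c , e) ∷ p) with Q? (mdeg e)
  ... | yes q = q ∷ filterDeg-terms Q? p
  ... | no _ = filterDeg-terms Q? p

  filterDeg-in : ∀ {N} {Q : ℕ → Set} (Q? : Decidable Q) (p : Pol N) m → Q (mdeg m) → coeff (filterDeg Q? p) m ≈ coeff p m
  filterDeg-in Q? [] m h = refl
  filterDeg-in {Q = Q} Q? ((c , e) ∷ p) m h with Q? (mdeg e)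
  ... | yes _ = trans (coeff-∷ (c , e) (filterDeg Q? p) m) (trans (+-congˡ (filterDeg-in Q? p m h)) (sym (coeff-∷ (c , e) p m)))
  ... | no ¬qe = begin
    coeff (filterDeg Q? p) m  ≈⟨ filterDeg-in Q? p m h ⟩
    coeff p m                 ≈⟨ sym (+-identityˡ _) ⟩
    0# + coeff p m            ≈⟨ +-congʳ (sym (coeffT-no c e m (λ eq → ¬qe (Eq.subst (λ z → Q (mdeg z)) (Eq.sym eq) h)))) ⟩
    coeffT (c , e) m + coeff p m ≈⟨ sym (coeff-∷ (c , e) p m) ⟩
    coeff ((c , e) ∷ p) m     ∎

  filterDeg-out : ∀ {N} {Q : ℕ → Set} (Q? : Decidable Q) (p : Pol N) m → ¬ Q (mdeg m) → coeff (filterDeg Q? p) m ≈ 0#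
  filterDeg-out {Q = Q} Q? p = termsIn⇒degreesIn {Q = Q} (filterDeg Q? p) (filterDeg-terms Q? p)

  degreesIn⇒filterDeg : ∀ {N} {Q : ℕ → Set} (Q? : Decidable Q) (p : Pol N) → DegreesIn Q p → p ≐ filterDeg Q? p
  degreesIn⇒filterDeg Q? p h = coeffwise (λ m → lemma m (Q? (mdeg m)))
    where
    lemma : ∀ m → Dec _ → coeff p m ≈ coeff (filterDeg Q? p) m
    lemma m (yes q) = sym (filterDeg-in Q? p m q)
    lemma m (no nq) = trans (h m nq) (sym (filterDeg-out Q? p m nq))

  degreesIn-≐ : ∀ {N} {Q : ℕ → Set} {p q : Pol N} → p ≐ q → DegreesIn Q p → DegreesIn Q q
  degreesIn-≐ pq h m nq = trans (sym (coeff≈ pq m)) (h m nq)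

  degreesIn-+ : ∀ {N} {Q : ℕ → Set} (p q : Pol N) → DegreesIn Q p → DegreesIn Q q → DegreesIn Q (p +P q)
  degreesIn-+ p q hp hq m nq = trans (coeff-++ p q m) (trans (+-cong (hp m nq) (hq m nq)) (+-identityˡ 0#))

  degreesIn-· : ∀ {N} {Q : ℕ → Set} k (p : Pol N) → DegreesIn Q p → DegreesIn Q (k ·P p)
  degreesIn-· k p hp m nq = trans (coeff-· k p m) (trans (*-congˡ (hp m nq)) (zeroʳ k))

  degreesIn-weaken : ∀ {N} {Q Q' : ℕ → Set} → (∀ d → Q d → Q' d) → (p : Pol N) → DegreesIn Q p → DegreesIn Q' p
  degreesIn-weaken w p h m nq = h m (λ q → nq (w _ q))

  -- Proved on the filtered
  -- representations, where it is a statement about individual terms.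
  termsIn-* : ∀ {N} {Q Q' Q'' : ℕ → Set} → (∀ x y → Q x → Q' y → Q'' (x ℕ.+ y)) →
    (p q : Pol N) → TermsIn Q p → TermsIn Q' q → TermsIn Q'' (p *P q)
  termsIn-* w [] q hp hq = []
  termsIn-* {Q = Q} {Q'} {Q''} w ((c , e) ∷ p) q (qe ∷ hp) hq = AllP.++⁺ (withTerm q hq) (termsIn-* {Q = Q} {Q'} {Q''} w p q hp hq)
    where
    withTerm : ∀ r → TermsIn Q' r → TermsIn Q'' (map (mulTerm (c , e)) r)
    withTerm [] [] = []
    withTerm ((d , f) ∷ r) (qf ∷ h) = Eq.subst Q'' (Eq.sym (mdeg-+ e f)) (w _ _ qe qf) ∷ withTerm r h

  degreesIn-* : ∀ {N} {Q Q' Q'' : ℕ → Set} (Q? : Decidable Q) (Q'? : Decidable Q') →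
    (∀ x y → Q x → Q' y → Q'' (x ℕ.+ y)) →
    (p q : Pol N) → DegreesIn Q p → DegreesIn Q' q → DegreesIn Q'' (p *P q)
  degreesIn-* {Q = Q} {Q'} {Q''} Q? Q'? w p q hp hq =
    degreesIn-≐ {Q = Q''} (*P-cong (≐-sym (degreesIn⇒filterDeg Q? p hp)) (≐-sym (degreesIn⇒filterDeg Q'? q hq)))
      (termsIn⇒degreesIn {Q = Q''} _ (termsIn-* {Q = Q} {Q'} {Q''} w (filterDeg Q? p) (filterDeg Q'? q) (filterDeg-terms Q? p) (filterDeg-terms Q'? q)))

  MinDeg : ∀ {N} → ℕ → Pol N → Set ℓ
  MinDeg k = DegreesIn (k ≤_)

  MaxDeg : ∀ {N} → ℕ → Pol N → Set ℓ
  MaxDeg D = DegreesIn (_≤ D)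

  minDeg-* : ∀ {N} {j k} (p q : Pol N) → MinDeg j p → MinDeg k q → MinDeg (j ℕ.+ k) (p *P q)
  minDeg-* {j = j} {k} = degreesIn-* {Q'' = j ℕ.+ k ≤_} (j ℕ.≤?_) (k ℕ.≤?_) (λ x y → ℕP.+-mono-≤)

  maxDeg-* : ∀ {N} {j k} (p q : Pol N) → MaxDeg j p → MaxDeg k q → MaxDeg (j ℕ.+ k) (p *P q)
  maxDeg-* {j = j} {k} = degreesIn-* {Q'' = _≤ j ℕ.+ k} (ℕ._≤? j) (ℕ._≤? k) (λ x y → ℕP.+-mono-≤)

  minDeg-0 : ∀ {N} (p : Pol N) → MinDeg 0 p
  minDeg-0 p m nq = contradiction ℕ.z≤n nq

  minDeg-weaken : ∀ {N} {j k} → j ≤ k → (p : Pol N) → MinDeg k p → MinDeg j p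
  minDeg-weaken {j = j} {k} jk = degreesIn-weaken {Q = k ≤_} {j ≤_} (λ d kd → ℕP.≤-trans jk kd)

  maxDeg-weaken : ∀ {N} {j k} → j ≤ k → (p : Pol N) → MaxDeg j p → MaxDeg k p
  maxDeg-weaken {j = j} {k} jk = degreesIn-weaken {Q = _≤ j} {_≤ k} (λ d dj → ℕP.≤-trans dj jk)

  minDeg-^ : ∀ {N} j (x : Pol N) i → MinDeg j x → MinDeg (i ℕ.* j) (x ^P i)
  minDeg-^ j x zero h = minDeg-0 (constP 1#)
  minDeg-^ j x (suc i) h = minDeg-* x (x ^P i) h (minDeg-^ j x i h)

  maxDeg-const1 : ∀ {N} → MaxDeg {N} 0 (constP 1#)
  maxDeg-const1 {N} = termsIn⇒degreesIn {Q = _≤ 0} (constP 1#) (ℕP.≤-reflexive (mdeg-0 {N}) ∷ [])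

  maxDeg-^ : ∀ {N} j (x : Pol N) k → MaxDeg j x → MaxDeg (k ℕ.* j) (x ^P k)
  maxDeg-^ j x zero h = maxDeg-const1
  maxDeg-^ j x (suc k) h = maxDeg-* x (x ^P k) h (maxDeg-^ j x k h)

  maxdeg : ∀ {N} → Pol N → ℕ
  maxdeg [] = 0
  maxdeg (t ∷ p) = mdeg (proj₂ t) ⊔ maxdeg p

  maxdeg-bound : ∀ {N} (p : Pol N) → MaxDeg (maxdeg p) p
  maxdeg-bound p = termsIn⇒degreesIn {Q = _≤ maxdeg p} p (terms p)
    where
    terms : ∀ p → TermsIn (_≤ maxdeg p) p
    terms [] = []
    terms (t ∷ p) = ℕP.m≤m⊔n _ _ ∷ All.map (λ h → ℕP.≤-trans h (ℕP.m≤n⊔m _ _)) (terms p)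

  Hom : ∀ {N} → ℕ → Pol N → Pol N
  Hom n = filterDeg (ℕ._≟ n)

  HomLe : ∀ {N} → ℕ → Pol N → Pol N
  HomLe n = filterDeg (ℕ._≤? n)

  HomLe-max : ∀ {N} n (p : Pol N) → MaxDeg n (HomLe n p)
  HomLe-max n p = filterDeg-out (ℕ._≤? n) p

  -- This
  -- is the right notion for truncated power series, and it is a congruence for
  -- + and * because no product of terms can lower the degree.
  infix 4 _≈[_]_
  record _≈[_]_ {N} (p : Pol N) (K : ℕ) (q : Pol N) : Set ℓ where
    constructor agreeUpTo
    field coeff≈≤ : ∀ m → mdeg m ≤ K → coeff p m ≈ coeff q m
  open _≈[_]_ public

  module _ {N : ℕ} {K : ℕ} where
    ≈K-refl : {p : Pol N} → p ≈[ K ] p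
    ≈K-refl = agreeUpTo (λ m _ → refl)

    ≈K-sym : {p q : Pol N} → p ≈[ K ] q → q ≈[ K ] p
    ≈K-sym h = agreeUpTo (λ m d → sym (coeff≈≤ h m d))

    ≈K-trans : {p q r : Pol N} → p ≈[ K ] q → q ≈[ K ] r → p ≈[ K ] r
    ≈K-trans h g = agreeUpTo (λ m d → trans (coeff≈≤ h m d) (coeff≈≤ g m d))

    ≐⇒≈K : {p q : Pol N} → p ≐ q → p ≈[ K ] q
    ≐⇒≈K h = agreeUpTo (λ m _ → coeff≈ h m)

    ≈K-+ : {p p' q q' : Pol N} → p ≈[ K ] p' → q ≈[ K ] q' → p +P q ≈[ K ] p' +P q'
    ≈K-+ {p} {p'} {q} {q'} h g = agreeUpTo λ m d →
      trans (coeff-++ p q m) (trans (+-cong (coeff≈≤ h m d) (coeff≈≤ g m d)) (sym (coeff-++ p' q' m)))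

    ≈K⇒minDeg : {p q : Pol N} → p ≈[ K ] q → MinDeg (suc K) (p +P negP q)
    ≈K⇒minDeg {p} {q} h m nq = trans (coeff-difference p q m) (x≈y⇒x∙y⁻¹≈ε (coeff≈≤ h m (ℕP.≮⇒≥ nq)))

    minDeg⇒≈K : {p q : Pol N} → MinDeg (suc K) (p +P negP q) → p ≈[ K ] q
    minDeg⇒≈K {p} {q} h = agreeUpTo λ m d →
      x∙y⁻¹≈ε⇒x≈y _ _ (trans (sym (coeff-difference p q m)) (h m (ℕP.≤⇒≯ d)))

    minDeg⇒≈K0 : (p : Pol N) → MinDeg (suc K) p → p ≈[ K ] []
    minDeg⇒≈K0 p h = agreeUpTo (λ m d → h m (ℕP.≤⇒≯ d))

    ≈K-*ˡ : {p p' : Pol N} (q : Pol N) → p ≈[ K ] p' → p *P q ≈[ K ] p' *P q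
    ≈K-*ˡ {p} {p'} q h = minDeg⇒≈K (degreesIn-≐ {Q = suc K ≤_} ([y-z]x≈yx-zx q p p') difference-min)
      where
      open import Algebra.Properties.Ring (CommutativeRing.ring (PolR N)) using ([y-z]x≈yx-zx)
      difference-min : MinDeg (suc K) ((p +P negP p') *P q)
      difference-min = Eq.subst (λ z → MinDeg z ((p +P negP p') *P q)) (ℕP.+-identityʳ (suc K))
                         (minDeg-* (p +P negP p') q (≈K⇒minDeg h) (minDeg-0 q))

    ≈K-* : {p p' q q' : Pol N} → p ≈[ K ] p' → q ≈[ K ] q' → p *P q ≈[ K ] p' *P q'
    ≈K-* {p} {p'} {q} {q'} h g =
      ≈K-trans (≈K-*ˡ q h) (≈K-trans (≐⇒≈K (*P-comm p' q)) (≈K-trans (≈K-*ˡ p' g) (≐⇒≈K (*P-comm q' p'))))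

    ^P-≈K : {p q : Pol N} (k : ℕ) → p ≈[ K ] q → p ^P k ≈[ K ] q ^P k
    ^P-≈K zero h = ≈K-refl
    ^P-≈K (suc k) h = ≈K-* h (^P-≈K k h)

  infix 1 beginK_
  infixr 2 _≈K⟨_⟩_ _≐K⟨_⟩_
  infix 3 _∎K

  beginK_ : ∀ {N K} {p q : Pol N} → p ≈[ K ] q → p ≈[ K ] q
  beginK h = h

  _≈K⟨_⟩_ : ∀ {N K} (p : Pol N) {q r : Pol N} → p ≈[ K ] q → q ≈[ K ] r → p ≈[ K ] r
  p ≈K⟨ h ⟩ g = ≈K-trans h g

  _≐K⟨_⟩_ : ∀ {N K} (p : Pol N) {q r : Pol N} → p ≐ q → q ≈[ K ] r → p ≈[ K ] r
  p ≐K⟨ h ⟩ g = ≈K-trans (≐⇒≈K h) g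

  _∎K : ∀ {N K} (p : Pol N) → p ≈[ K ] p
  p ∎K = ≈K-refl

  Hom-≈K : ∀ {N} n {p q : Pol N} → p ≈[ n ] q → Hom n p ≐ Hom n q
  Hom-≈K n {p} {q} h = coeffwise λ m → lemma m (mdeg m ℕ.≟ n)
    where
    lemma : ∀ m → Dec (mdeg m ≡ n) → coeff (Hom n p) m ≈ coeff (Hom n q) m
    lemma m (yes eq) = trans (filterDeg-in (ℕ._≟ n) p m eq) (trans (coeff≈≤ h m (ℕP.≤-reflexive eq)) (sym (filterDeg-in (ℕ._≟ n) q m eq)))
    lemma m (no ne) = trans (filterDeg-out (ℕ._≟ n) p m ne) (sym (filterDeg-out (ℕ._≟ n) q m ne))

  HomLe-≈K : ∀ {N} n (p : Pol N) → HomLe n p ≈[ n ] p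
  HomLe-≈K n p = agreeUpTo (filterDeg-in (ℕ._≤? n) p)

  -- Field facts.  Characteristic zero is used only to know that the numbers
  -- 2^m (as field elements) are pairwise distinct and that factorials are
  -- invertible.
  Nonzero : Carrier → Set ℓ
  Nonzero x = ¬ (x ≈ 0#)

  inv : (x : Carrier) → Nonzero x → Carrier
  inv x nz = proj₁ (inverse x nz)

  inv-r : (x : Carrier) (nz : Nonzero x) → x * inv x nz ≈ 1#
  inv-r x nz = proj₂ (inverse x nz)

  inv-l : (x : Carrier) (nz : Nonzero x) → inv x nz * x ≈ 1#
  inv-l x nz = trans (*-comm _ _) (inv-r x nz)

  nonzero-* : ∀ {x y} → Nonzero x → Nonzero y → Nonzero (x * y)
  nonzero-* {x} {y} nx ny xy≈0 = ny (begin
    y                  ≈⟨ sym (*-identityˡ y) ⟩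
    1# * y             ≈⟨ *-congʳ (sym (inv-l x nx)) ⟩
    (inv x nx * x) * y ≈⟨ *-assoc _ _ _ ⟩
    inv x nx * (x * y) ≈⟨ *-congˡ xy≈0 ⟩
    inv x nx * 0#      ≈⟨ zeroʳ _ ⟩
    0#                 ∎)

  nonzero-1 : Nonzero 1#
  nonzero-1 h = 0≉1 (sym h)

  difference-nonzero : ∀ x y → ¬ (x ≈ y) → Nonzero (x - y)
  difference-nonzero x y ne h = ne (x∙y⁻¹≈ε⇒x≈y x y h)

  ι : ℕ → Carrier
  ι n = n •1⟨ commutativeRing ⟩

  ι-+ : ∀ m n → ι (m ℕ.+ n) ≈ ι m + ι n
  ι-+ zero n = sym (+-identityˡ _)
  ι-+ (suc m) n = trans (+-congˡ (ι-+ m n)) (sym (+-assoc _ _ _))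

  ι-* : ∀ m n → ι (m ℕ.* n) ≈ ι m * ι n
  ι-* zero n = sym (zeroˡ _)
  ι-* (suc m) n = begin
    ι (n ℕ.+ m ℕ.* n)        ≈⟨ ι-+ n (m ℕ.* n) ⟩
    ι n + ι (m ℕ.* n)        ≈⟨ +-cong (sym (*-identityˡ _)) (ι-* m n) ⟩
    1# * ι n + ι m * ι n     ≈⟨ sym (distribʳ _ _ _) ⟩
    (1# + ι m) * ι n         ∎

  -- Characteristic zero makes ι injective: ι (m + 1 + o) = ι m + ι (1 + o) and
  -- ι (1 + o) ≠ 0.
  ι-< : ∀ {m n} → m < n → ¬ (ι m ≈ ι n)
  ι-< {m} {n} m<n h with ℕP.m≤n⇒∃[o]m+o≡n m<n
  ... | (o , eq) = charZero o (identityʳ-unique (ι m) (ι (suc o)) (begin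
    ι m + ι (suc o)   ≈⟨ sym (ι-+ m (suc o)) ⟩
    ι (m ℕ.+ suc o)   ≡⟨ Eq.cong ι (Eq.trans (ℕP.+-suc m o) eq) ⟩
    ι n               ≈⟨ sym h ⟩
    ι m               ∎))

  ι-injective : ∀ m n → m ≢ n → ¬ (ι m ≈ ι n)
  ι-injective m n ne h with ℕP.<-cmp m n
  ... | tri< lt _ _ = ι-< lt h
  ... | tri≈ _ eq _ = ne eq
  ... | tri> _ _ gt = ι-< gt (sym h)

  ^F-+ : ∀ x m n → x ^F (m ℕ.+ n) ≈ x ^F m * x ^F n
  ^F-+ x zero n = sym (*-identityˡ _)
  ^F-+ x (suc m) n = trans (*-congˡ (^F-+ x m n)) (sym (*-assoc _ _ _))

  ^F-distrib-* : ∀ x y m → (x * y) ^F m ≈ x ^F m * y ^F m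
  ^F-distrib-* x y zero = sym (*-identityˡ 1#)
  ^F-distrib-* x y (suc m) = trans (*-congˡ (^F-distrib-* x y m)) (*-interchange x y (x ^F m) (y ^F m))

  ^F-1 : ∀ m → 1# ^F m ≈ 1#
  ^F-1 zero = refl
  ^F-1 (suc m) = trans (*-identityˡ _) (^F-1 m)

  ι-^ : ∀ b m → ι (b ℕ.^ m) ≈ ι b ^F m
  ι-^ b zero = +-identityʳ 1#
  ι-^ b (suc m) = trans (ι-* b (b ℕ.^ m)) (*-congˡ (ι-^ b m))

  two : Carrier
  two = ι 2

  two-nonzero : Nonzero two
  two-nonzero = charZero 1

  2^-injective : ∀ m n → 2 ℕ.^ m ≡ 2 ℕ.^ n → m ≡ n
  2^-injective zero zero h = Eq.refl
  2^-injective zero (suc n) h = contradiction (Eq.subst (2 ≤_) (Eq.sym h) (2≤2^suc n)) (λ { (ℕ.s≤s ()) })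
    where
    2≤2^suc : ∀ n → 2 ≤ 2 ℕ.^ suc n
    2≤2^suc n = ℕP.*-monoʳ-≤ 2 (ℕP.m^n>0 2 n)
  2^-injective (suc m) zero h = Eq.sym (2^-injective zero (suc m) (Eq.sym h))
  2^-injective (suc m) (suc n) h = Eq.cong suc (2^-injective m n (ℕP.*-cancelˡ-≡ (2 ℕ.^ m) (2 ℕ.^ n) 2 h))

  two^-injective : ∀ m n → m ≢ n → ¬ (two ^F m ≈ two ^F n)
  two^-injective m n ne h =
    ι-injective (2 ℕ.^ m) (2 ℕ.^ n) (λ eq → ne (2^-injective m n eq)) (trans (ι-^ 2 m) (trans h (sym (ι-^ 2 n))))

  -- It is a ring homomorphism and scalings compose; this is
  -- what makes the ∧-inputs of our circuits siblings of the Rᵢⱼ.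
  coeffT-scale : ∀ {N} β c (e m : Monomial N) → coeffT (c * β ^F mdeg e , e) m ≈ β ^F mdeg m * coeffT (c , e) m
  coeffT-scale β c e m with ≡-dec _≟ℕ_ e m
  ... | yes Eq.refl = trans (+-identityʳ _) (trans (*-comm _ _) (*-congˡ (sym (+-identityʳ c))))
  ... | no _ = sym (zeroʳ _)

  coeff-scale : ∀ {N} β (p : Pol N) m → coeff (scaleVars β p) m ≈ β ^F mdeg m * coeff p m
  coeff-scale β p m = begin
    coeff (scaleVars β p) m                                          ≈⟨ coeff-sumL (scaleVars β p) m ⟩
    sumL (scaleVars β p) (λ t → coeffT t m)                          ≈⟨ sumL-map p _ _ ⟩
    sumL p (λ t → coeffT (proj₁ t * β ^F mdeg (proj₂ t) , proj₂ t) m) ≈⟨ sumL-cong p (λ t → coeffT-scale β (proj₁ t) (proj₂ t) m) ⟩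
    sumL p (λ t → β ^F mdeg m * coeffT t m)                          ≈⟨ sym (sumL-*ˡ p _ _) ⟩
    β ^F mdeg m * sumL p (λ t → coeffT t m)                          ≈⟨ *-congˡ (sym (coeff-sumL p m)) ⟩
    β ^F mdeg m * coeff p m                                          ∎

  scaleVars-comp : ∀ {N} β γ (p : Pol N) → scaleVars β (scaleVars γ p) ≐ scaleVars (β * γ) p
  scaleVars-comp β γ p = coeffwise λ m → begin
    coeff (scaleVars β (scaleVars γ p)) m      ≈⟨ coeff-scale β (scaleVars γ p) m ⟩
    β ^F mdeg m * coeff (scaleVars γ p) m      ≈⟨ *-congˡ (coeff-scale γ p m) ⟩
    β ^F mdeg m * (γ ^F mdeg m * coeff p m)    ≈⟨ sym (*-assoc _ _ _) ⟩
    (β ^F mdeg m * γ ^F mdeg m) * coeff p m    ≈⟨ *-congʳ (sym (^F-distrib-* β γ (mdeg m))) ⟩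
    (β * γ) ^F mdeg m * coeff p m              ≈⟨ sym (coeff-scale (β * γ) p m) ⟩
    coeff (scaleVars (β * γ) p) m              ∎

  scaleVars-* : ∀ {N} β (p q : Pol N) → scaleVars β (p *P q) ≐ scaleVars β p *P scaleVars β q
  scaleVars-* β p q = coeffwise λ m → begin
    coeff (scaleVars β (p *P q)) m
      ≈⟨ coeff-scale β (p *P q) m ⟩
    β ^F mdeg m * coeff (p *P q) m
      ≈⟨ *-congˡ (coeff-* p q m) ⟩
    β ^F mdeg m * sumL p (λ t → sumL q (λ u → coeffT (mulTerm t u) m))
      ≈⟨ sumL-*ˡ p _ _ ⟩
    sumL p (λ t → β ^F mdeg m * sumL q (λ u → coeffT (mulTerm t u) m))
      ≈⟨ sumL-cong p (λ t → sumL-*ˡ q _ _) ⟩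
    sumL p (λ t → sumL q (λ u → β ^F mdeg m * coeffT (mulTerm t u) m))
      ≈⟨ sym (sumL-cong p (λ t → sumL-cong q (λ u → scaled-mulTerm t u m))) ⟩
    sumL p (λ t → sumL q (λ u → coeffT (mulTerm (scaled t) (scaled u)) m))
      ≈⟨ sym (sumL-map p _ _) ⟩
    sumL (scaleVars β p) (λ t → sumL q (λ u → coeffT (mulTerm t (scaled u)) m))
      ≈⟨ sym (sumL-cong (scaleVars β p) (λ t → sumL-map q _ _)) ⟩
    sumL (scaleVars β p) (λ t → sumL (scaleVars β q) (λ u → coeffT (mulTerm t u) m))
      ≈⟨ sym (coeff-* (scaleVars β p) (scaleVars β q) m) ⟩
    coeff (scaleVars β p *P scaleVars β q) m ∎
    where
    scaled : Term _ → Term _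
    scaled t = (proj₁ t * β ^F mdeg (proj₂ t) , proj₂ t)
    scaled-mulTerm : ∀ t u m → coeffT (mulTerm (scaled t) (scaled u)) m ≈ β ^F mdeg m * coeffT (mulTerm t u) m
    scaled-mulTerm (c , e) (d , f) m = trans (coeffT-cong (e +v f) m factors) (coeffT-scale β (c * d) (e +v f) m)
      where
      factors : (c * β ^F mdeg e) * (d * β ^F mdeg f) ≈ (c * d) * β ^F mdeg (e +v f)
      factors = trans (*-interchange c _ d _)
                      (*-congˡ (trans (sym (^F-+ β (mdeg e) (mdeg f))) (reflexive (Eq.cong (β ^F_) (Eq.sym (mdeg-+ e f))))))

  scaleVars-1 : ∀ {N} β → scaleVars {N} β (constP 1#) ≐ constP 1#
  scaleVars-1 {N} β = coeffwise λ m → trans (coeff-scale β (constP 1#) m) (lemma m (≡-dec _≟ℕ_ 0v m))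
    where
    lemma : ∀ m → Dec (0v ≡ m) → β ^F mdeg m * coeff {N} (constP 1#) m ≈ coeff (constP 1#) m
    lemma m (yes Eq.refl) = trans (*-congʳ (reflexive (Eq.cong (β ^F_) (mdeg-0 {N})))) (*-identityˡ _)
    lemma m (no ne) = trans (*-congˡ (coeffT-no 1# 0v m ne)) (trans (zeroʳ _) (sym (coeffT-no 1# 0v m ne)))

  scaleVars-^ : ∀ {N} β (p : Pol N) k → scaleVars β (p ^P k) ≐ scaleVars β p ^P k
  scaleVars-^ β p zero = scaleVars-1 β
  scaleVars-^ β p (suc k) = ≐-trans (scaleVars-* β p (p ^P k)) (*P-cong (≐-refl {p = scaleVars β p}) (scaleVars-^ β p k))

  Scalings : Set a
  Scalings = List (Carrier × Carrier)

  applyScalings : ∀ {N} → Scalings → Pol N → Pol N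
  applyScalings os p = sumP (map (λ o → proj₁ o ·P scaleVars (proj₂ o) p) os)

  multiplier : Scalings → ℕ → Carrier
  multiplier os d = sumL os (λ o → proj₁ o * proj₂ o ^F d)

  coeff-applyScalings : ∀ {N} (os : Scalings) (p : Pol N) m → coeff (applyScalings os p) m ≈ multiplier os (mdeg m) * coeff p m
  coeff-applyScalings [] p m = sym (zeroˡ _)
  coeff-applyScalings ((v , σ) ∷ os) p m = begin
    coeff ((v ·P scaleVars σ p) +P applyScalings os p) m
      ≈⟨ coeff-++ (v ·P scaleVars σ p) (applyScalings os p) m ⟩
    coeff (v ·P scaleVars σ p) m + coeff (applyScalings os p) m
      ≈⟨ +-cong (trans (coeff-· v (scaleVars σ p) m) (*-congˡ (coeff-scale σ p m))) (coeff-applyScalings os p m) ⟩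
    v * (σ ^F mdeg m * coeff p m) + multiplier os (mdeg m) * coeff p m
      ≈⟨ +-congʳ (sym (*-assoc _ _ _)) ⟩
    (v * σ ^F mdeg m) * coeff p m + multiplier os (mdeg m) * coeff p m
      ≈⟨ sym (distribʳ _ _ _) ⟩
    multiplier ((v , σ) ∷ os) (mdeg m) * coeff p m ∎

  -- To extract the degree-n part of a polynomial p of degree ≤ D
  -- we look for weights wᵢ with Σᵢ wᵢ (2^i)^d = [d = n] for all d ≤ D; then
  -- Σᵢ wᵢ p(2^i X) = Hom n p.  Writing Σᵢ wᵢ x^i as the polynomial
  -- Π_{b ≤ D, b ≠ n} (x - 2^b) / Π_{b ≤ D, b ≠ n} (2^n - 2^b), whose value at 2^d
  -- is exactly [d = n], the weights are its coefficients.  Univariate polynomials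
  -- are handled here as coefficient lists evaluated by Horner's rule.
  horner : List Carrier → Carrier → Carrier
  horner [] x = 0#
  horner (w ∷ ws) x = w + x * horner ws x

  hornerScalings : List Carrier → Scalings
  hornerScalings [] = []
  hornerScalings (w ∷ ws) = (w , 1#) ∷ map (λ o → (proj₁ o , two * proj₂ o)) (hornerScalings ws)

  multiplier-hornerScalings : ∀ ws d → multiplier (hornerScalings ws) d ≈ horner ws (two ^F d)
  multiplier-hornerScalings [] d = refl
  multiplier-hornerScalings (w ∷ ws) d = +-cong (trans (*-congˡ (^F-1 d)) (*-identityʳ w)) (begin
    sumL (map (λ o → (proj₁ o , two * proj₂ o)) os) (λ o → proj₁ o * proj₂ o ^F d)
      ≈⟨ sumL-map os _ _ ⟩
    sumL os (λ o → proj₁ o * (two * proj₂ o) ^F d)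
      ≈⟨ sumL-cong os (λ o → trans (*-congˡ (^F-distrib-* two (proj₂ o) d)) (*-leftSwap _ _ _)) ⟩
    sumL os (λ o → two ^F d * (proj₁ o * proj₂ o ^F d))
      ≈⟨ sym (sumL-*ˡ os _ _) ⟩
    two ^F d * multiplier os d
      ≈⟨ *-congˡ (multiplier-hornerScalings ws d) ⟩
    two ^F d * horner ws (two ^F d) ∎)
    where os = hornerScalings ws

  hornerScalings-nonzero : ∀ ws → All (λ o → Nonzero (proj₂ o)) (hornerScalings ws)
  hornerScalings-nonzero [] = []
  hornerScalings-nonzero (w ∷ ws) = nonzero-1 ∷ AllP.map⁺ (All.map (nonzero-* two-nonzero) (hornerScalings-nonzero ws))

  hornerScalings-length : ∀ ws → length (hornerScalings ws) ≡ length ws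
  hornerScalings-length [] = Eq.refl
  hornerScalings-length (w ∷ ws) = Eq.cong suc (Eq.trans (LP.length-map _ (hornerScalings ws)) (hornerScalings-length ws))

  addCoeffs : List Carrier → List Carrier → List Carrier
  addCoeffs [] v = v
  addCoeffs (x ∷ u) [] = x ∷ u
  addCoeffs (x ∷ u) (y ∷ v) = (x + y) ∷ addCoeffs u v

  horner-addCoeffs : ∀ u v x → horner (addCoeffs u v) x ≈ horner u x + horner v x
  horner-addCoeffs [] v x = sym (+-identityˡ _)
  horner-addCoeffs (w ∷ u) [] x = sym (+-identityʳ _)
  horner-addCoeffs (w ∷ u) (y ∷ v) x =
    trans (+-congˡ (trans (*-congˡ (horner-addCoeffs u v x)) (distribˡ x _ _))) (+-interchange w y _ _)

  addCoeffs-length : ∀ u v → length (addCoeffs u v) ≡ length u ⊔ length v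
  addCoeffs-length [] v = Eq.refl
  addCoeffs-length (x ∷ u) [] = Eq.refl
  addCoeffs-length (x ∷ u) (y ∷ v) = Eq.cong suc (addCoeffs-length u v)

  horner-scale : ∀ k u x → horner (map (k *_) u) x ≈ k * horner u x
  horner-scale k [] x = sym (zeroʳ k)
  horner-scale k (w ∷ u) x =
    trans (+-congˡ (trans (*-congˡ (horner-scale k u x)) (*-leftSwap x k _))) (sym (distribˡ k _ _))

  mulLinear : Carrier → List Carrier → List Carrier
  mulLinear c u = addCoeffs (map ((- c) *_) u) (0# ∷ u)

  horner-mulLinear : ∀ c u x → horner (mulLinear c u) x ≈ (x - c) * horner u x
  horner-mulLinear c u x = begin
    horner (addCoeffs (map ((- c) *_) u) (0# ∷ u)) x ≈⟨ horner-addCoeffs (map ((- c) *_) u) (0# ∷ u) x ⟩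
    horner (map ((- c) *_) u) x + (0# + x * h)        ≈⟨ +-cong (horner-scale (- c) u x) (+-identityˡ _) ⟩
    - c * h + x * h                                   ≈⟨ +-comm _ _ ⟩
    x * h + - c * h                                   ≈⟨ sym (distribʳ h x (- c)) ⟩
    (x - c) * h                                       ∎
    where h = horner u x

  mulLinear-length : ∀ c u → length (mulLinear c u) ≡ suc (length u)
  mulLinear-length c u = Eq.trans (addCoeffs-length (map ((- c) *_) u) (0# ∷ u))
    (Eq.trans (Eq.cong (_⊔ suc (length u)) (LP.length-map _ u)) (ℕP.m≤n⇒m⊔n≡n (ℕP.n≤1+n (length u))))

  vanishing : List ℕ → Carrier → Carrier
  vanishing [] x = 1#
  vanishing (b ∷ bs) x = (x - two ^F b) * vanishing bs x

  vanishingCoeffs : List ℕ → List Carrier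
  vanishingCoeffs [] = 1# ∷ []
  vanishingCoeffs (b ∷ bs) = mulLinear (two ^F b) (vanishingCoeffs bs)

  horner-vanishingCoeffs : ∀ bs x → horner (vanishingCoeffs bs) x ≈ vanishing bs x
  horner-vanishingCoeffs [] x = trans (+-congˡ (zeroʳ x)) (+-identityʳ 1#)
  horner-vanishingCoeffs (b ∷ bs) x = trans (horner-mulLinear _ (vanishingCoeffs bs) x) (*-congˡ (horner-vanishingCoeffs bs x))

  vanishingCoeffs-length : ∀ bs → length (vanishingCoeffs bs) ≡ suc (length bs)
  vanishingCoeffs-length [] = Eq.refl
  vanishingCoeffs-length (b ∷ bs) = Eq.trans (mulLinear-length _ (vanishingCoeffs bs)) (Eq.cong suc (vanishingCoeffs-length bs))

  nodesExcept : ℕ → ℕ → List ℕ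
  nodesExcept zero n = []
  nodesExcept (suc k) n with k ℕ.≟ n
  ... | yes _ = nodesExcept k n
  ... | no _ = k ∷ nodesExcept k n

  nodesExcept-length : ∀ k n → length (nodesExcept k n) ≤ k
  nodesExcept-length zero n = ℕ.z≤n
  nodesExcept-length (suc k) n with k ℕ.≟ n
  ... | yes _ = ℕP.m≤n⇒m≤1+n (nodesExcept-length k n)
  ... | no _ = ℕ.s≤s (nodesExcept-length k n)

  vanishing-zero : ∀ k n d → d < k → d ≢ n → vanishing (nodesExcept k n) (two ^F d) ≈ 0#
  vanishing-zero (suc k) n d d<k dn with k ℕ.≟ n | ℕP.m≤n⇒m<n∨m≡n (ℕP.≤-pred d<k)
  ... | yes _ | inj₁ lt = vanishing-zero k n d lt dn
  ... | yes kn | inj₂ eq = contradiction (Eq.trans eq kn) dn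
  ... | no _ | inj₁ lt = trans (*-congˡ (vanishing-zero k n d lt dn)) (zeroʳ _)
  ... | no _ | inj₂ Eq.refl = trans (*-congʳ (-‿inverseʳ _)) (zeroˡ _)

  vanishing-nonzero : ∀ k n → Nonzero (vanishing (nodesExcept k n) (two ^F n))
  vanishing-nonzero zero n = nonzero-1
  vanishing-nonzero (suc k) n with k ℕ.≟ n
  ... | yes _ = vanishing-nonzero k n
  ... | no kn = nonzero-* (difference-nonzero _ _ (two^-injective n k (λ eq → kn (Eq.sym eq)))) (vanishing-nonzero k n)

  module _ (D n : ℕ) where
    private
      nodes : List ℕ
      nodes = nodesExcept (suc D) n

      normaliser : Carrier
      normaliser = inv (vanishing nodes (two ^F n)) (vanishing-nonzero (suc D) n)

    extractor : Scalings
    extractor = hornerScalings (map (normaliser *_) (vanishingCoeffs nodes))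

    extractor-length : length extractor ≤ suc (suc D)
    extractor-length = Eq.subst (_≤ suc (suc D)) (Eq.sym length-eq) (ℕ.s≤s (nodesExcept-length (suc D) n))
      where
      length-eq : length extractor ≡ suc (length nodes)
      length-eq = Eq.trans (hornerScalings-length (map (normaliser *_) (vanishingCoeffs nodes)))
                    (Eq.trans (LP.length-map _ (vanishingCoeffs nodes)) (vanishingCoeffs-length nodes))

    extractor-nonzero : All (λ o → Nonzero (proj₂ o)) extractor
    extractor-nonzero = hornerScalings-nonzero _

    extractor-multiplier : ∀ d → multiplier extractor d ≈ normaliser * vanishing nodes (two ^F d)
    extractor-multiplier d = begin
      multiplier extractor d                                      ≈⟨ multiplier-hornerScalings (map (normaliser *_) (vanishingCoeffs nodes)) d ⟩
      horner (map (normaliser *_) (vanishingCoeffs nodes)) (two ^F d) ≈⟨ horner-scale normaliser (vanishingCoeffs nodes) (two ^F d) ⟩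
      normaliser * horner (vanishingCoeffs nodes) (two ^F d)     ≈⟨ *-congˡ (horner-vanishingCoeffs nodes (two ^F d)) ⟩
      normaliser * vanishing nodes (two ^F d)                    ∎

    extract : ∀ {N} (p : Pol N) → MaxDeg D p → applyScalings extractor p ≐ Hom n p
    extract p hp = coeffwise λ m → trans (coeff-applyScalings extractor p m) (lemma m (mdeg m ℕ.≟ n) (mdeg m ℕ.≤? D))
      where
      lemma : ∀ m → Dec (mdeg m ≡ n) → Dec (mdeg m ≤ D) → multiplier extractor (mdeg m) * coeff p m ≈ coeff (Hom n p) m
      lemma m (yes eq) _ = begin
        multiplier extractor (mdeg m) * coeff p m ≡⟨ Eq.cong (λ d → multiplier extractor d * coeff p m) eq ⟩
        multiplier extractor n * coeff p m        ≈⟨ *-congʳ (trans (extractor-multiplier n) (inv-l _ _)) ⟩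
        1# * coeff p m                            ≈⟨ *-identityˡ _ ⟩
        coeff p m                                 ≈⟨ sym (filterDeg-in (ℕ._≟ n) p m eq) ⟩
        coeff (Hom n p) m                         ∎
      lemma m (no ne) (yes le) = begin
        multiplier extractor (mdeg m) * coeff p m ≈⟨ *-congʳ (extractor-multiplier (mdeg m)) ⟩
        (normaliser * vanishing nodes (two ^F mdeg m)) * coeff p m
          ≈⟨ *-congʳ (trans (*-congˡ (vanishing-zero (suc D) n (mdeg m) (ℕ.s≤s le) ne)) (zeroʳ _)) ⟩
        0# * coeff p m                            ≈⟨ zeroˡ _ ⟩
        0#                                        ≈⟨ sym (filterDeg-out (ℕ._≟ n) p m ne) ⟩
        coeff (Hom n p) m                         ∎
      lemma m (no ne) (no gt) =
        trans (*-congˡ (hp m gt)) (trans (zeroʳ _) (sym (filterDeg-out (ℕ._≟ n) p m ne)))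

  -- Constant polynomials and scalar multiples.  Scalar multiplication c ·P p
  -- agrees with multiplication by the constant polynomial κ c, which transfers
  -- the ring laws to it.
  κ : ∀ {N} → Carrier → Pol N
  κ c = constP c

  κ-cong : ∀ {N} {c d} → c ≈ d → κ {N} c ≐ κ d
  κ-cong {N} h = coeffwise (λ m → coeffT-cong (0v {N}) m h)

  κ-0 : ∀ {N} → κ {N} 0# ≐ []
  κ-0 {N} = coeffwise λ m → trans (coeffT-cong (0v {N}) m (sym (zeroˡ 1#))) (trans (coeffT-* 0# 1# 0v m) (zeroˡ _))

  ·-as-* : ∀ {N} k (p : Pol N) → k ·P p ≐ κ k *P p
  ·-as-* k p = coeffwise λ m → begin
    coeff (k ·P p) m                                  ≈⟨ coeff-· k p m ⟩
    k * coeff p m                                     ≈⟨ *-congˡ (coeff-sumL p m) ⟩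
    k * sumL p (λ u → coeffT u m)                     ≈⟨ sumL-*ˡ p k _ ⟩
    sumL p (λ u → k * coeffT u m)                     ≈⟨ sumL-cong p (λ u → trans (sym (coeffT-* k (proj₁ u) (proj₂ u) m))
                                                                               (coeffT-≡ _ m (Eq.sym (v-idˡ (proj₂ u))))) ⟩
    sumL p (λ u → coeffT (mulTerm (k , 0v) u) m)      ≈⟨ sym (+-identityʳ _) ⟩
    sumL p (λ u → coeffT (mulTerm (k , 0v) u) m) + 0# ≈⟨ sym (coeff-* (κ k) p m) ⟩
    coeff (κ k *P p) m                                ∎

  ·-cong : ∀ {N} {c d} (p : Pol N) → c ≈ d → c ·P p ≐ d ·P p
  ·-cong {c = c} {d} p h = coeffwise λ m → trans (coeff-· c p m) (trans (*-congʳ h) (sym (coeff-· d p m)))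

  ·-assoc : ∀ {N} c d (p : Pol N) → c ·P (d ·P p) ≐ (c * d) ·P p
  ·-assoc c d p = coeffwise λ m →
    trans (coeff-· c (d ·P p) m) (trans (*-congˡ (coeff-· d p m)) (trans (sym (*-assoc _ _ _)) (sym (coeff-· (c * d) p m))))

  ·-distrib : ∀ {N} x y (p : Pol N) → (x + y) ·P p ≐ (x ·P p) +P (y ·P p)
  ·-distrib x y p = coeffwise λ m → begin
    coeff ((x + y) ·P p) m                ≈⟨ coeff-· (x + y) p m ⟩
    (x + y) * coeff p m                   ≈⟨ distribʳ _ _ _ ⟩
    x * coeff p m + y * coeff p m         ≈⟨ sym (+-cong (coeff-· x p m) (coeff-· y p m)) ⟩
    coeff (x ·P p) m + coeff (y ·P p) m   ≈⟨ sym (coeff-++ (x ·P p) (y ·P p) m) ⟩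
    coeff ((x ·P p) +P (y ·P p)) m        ∎

  ·-1 : ∀ {N} {c} (p : Pol N) → c ≈ 1# → c ·P p ≐ p
  ·-1 {c = c} p h = coeffwise λ m → trans (coeff-· c p m) (trans (*-congʳ h) (*-identityˡ _))

  ·-0 : ∀ {N} (p : Pol N) → 0# ·P p ≐ []
  ·-0 p = coeffwise λ m → trans (coeff-· 0# p m) (zeroˡ _)

  ·-*ˡ : ∀ {N} c (p q : Pol N) → (c ·P p) *P q ≐ c ·P (p *P q)
  ·-*ˡ c p q = beginP
    (c ·P p) *P q   ≐⟨ *P-congʳ q (·-as-* c p) ⟩
    (κ c *P p) *P q ≐⟨ *P-assoc (κ c) p q ⟩
    κ c *P (p *P q) ≐˘⟨ ·-as-* c (p *P q) ⟩
    c ·P (p *P q)   ∎P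

  ·-*ʳ : ∀ {N} c (p q : Pol N) → p *P (c ·P q) ≐ c ·P (p *P q)
  ·-*ʳ c p q = beginP
    p *P (c ·P q)   ≐⟨ *P-comm p (c ·P q) ⟩
    (c ·P q) *P p   ≐⟨ ·-*ˡ c q p ⟩
    c ·P (q *P p)   ≐⟨ ·P-cong c (*P-comm q p) ⟩
    c ·P (p *P q)   ∎P

  ^P-1 : ∀ {N} (x : Pol N) → x ^P 1 ≐ x
  ^P-1 x = ≐-trans (*P-comm x (constP 1#)) (*P-idˡ x)

  fact-nonzero : ∀ m → Nonzero (ι (m !))
  fact-nonzero m = Eq.subst (λ z → Nonzero (ι z)) (ℕP.suc-pred (m !) {{m ℕP.!≢0}}) (charZero (ℕ.pred (m !)))

  invFact : ℕ → Carrier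
  invFact m = inv (ι (m !)) (fact-nonzero m)

  invFact-0 : invFact 0 ≈ 1#
  invFact-0 = trans (sym (*-identityˡ _)) (trans (*-congʳ (sym (+-identityʳ 1#))) (inv-r (ι 1) (fact-nonzero 0)))

  invFact-1 : invFact 1 ≈ 1#
  invFact-1 = trans (sym (*-identityˡ _)) (trans (*-congʳ (sym (+-identityʳ 1#))) (inv-r (ι 1) (fact-nonzero 1)))

  binomial-factorials : ∀ {n k} → k ≤ n → (n C k) ℕ.* (k ! ℕ.* (n ∸ k) !) ≡ n !
  binomial-factorials {n} {k} k≤n = Eq.trans (Eq.cong (ℕ._* (k ! ℕ.* (n ∸ k) !)) (nCk≡n!/k![n-k]! k≤n))
    (m/n*n≡m {{k ℕP.!* (n ∸ k) !≢0}} (k![n∸k]!∣n! k≤n))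

  invFact-binom : ∀ {m k} → k ≤ m → invFact m * ι (m C k) ≈ invFact k * invFact (m ∸ k)
  invFact-binom {m} {k} k≤m = begin
    fm * ι (m C k)                            ≈⟨ sym (*-identityʳ _) ⟩
    (fm * ι (m C k)) * 1#                     ≈⟨ *-congˡ (sym units) ⟩
    (fm * ι (m C k)) * ((A * fk) * (B * fj))  ≈⟨ regroup fm (ι (m C k)) A fk B fj ⟩
    (fm * (ι (m C k) * (A * B))) * (fk * fj)  ≈⟨ *-congʳ (*-congˡ (trans (*-congˡ (sym (ι-* (k !) ((m ∸ k) !))))
                                                  (trans (sym (ι-* (m C k) _)) (reflexive (Eq.cong ι (binomial-factorials k≤m)))))) ⟩
    (fm * ι (m !)) * (fk * fj)                ≈⟨ *-congʳ (inv-l _ _) ⟩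
    1# * (fk * fj)                            ≈⟨ *-identityˡ _ ⟩
    fk * fj                                   ∎
    where
    fm = invFact m
    fk = invFact k
    fj = invFact (m ∸ k)
    A = ι (k !)
    B = ι ((m ∸ k) !)
    units : (A * fk) * (B * fj) ≈ 1#
    units = trans (*-cong (inv-r _ _) (inv-r _ _)) (*-identityˡ 1#)
    open Solver
    regroup : ∀ fm c a fk b fj → (fm * c) * ((a * fk) * (b * fj)) ≈ (fm * (c * (a * b))) * (fk * fj)
    regroup = solve 6 (λ fm c a fk b fj → (fm :* c) :* ((a :* fk) :* (b :* fj)) := (fm :* (c :* (a :* b))) :* (fk :* fj)) refl

  expT : ∀ {N} → ℕ → Pol N → Pol N
  expT {N} n x = PolySum.sumN N (suc n) (λ i → invFact i ·P (x ^P i))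

  expT-0 : ∀ {N} n → expT {N} n [] ≐ κ 1#
  expT-0 {N} n = beginP
    expT n []                    ≐⟨ PolySum.sumN-front N n term ⟩
    term 0 +P PolySum.sumN N n (λ i → term (suc i))
                                 ≐⟨ +P-cong (·-1 (constP 1#) invFact-0) (PolySum.sumN-0 N n (λ i → term (suc i)) (λ i _ → higher i)) ⟩
    κ 1# +P []                   ≐⟨ +P-idʳ (κ 1#) ⟩
    κ 1#                         ∎P
    where
    term = λ i → invFact i ·P ([] ^P i)
    higher : ∀ i → term (suc i) ≐ []
    higher i = coeffwise (λ m → refl)

  module _ {N : ℕ} where
    open PolySum N using (sumN; sumN-cong; sumN-split; sumN-prod; sumN-fin; triangle; sumN-*ˡ; sumN-front)

    sumN-≈K : ∀ {K} n {f g : ℕ → Pol N} → (∀ i → i < n → f i ≈[ K ] g i) → sumN n f ≈[ K ] sumN n g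
    sumN-≈K zero h = ≈K-refl
    sumN-≈K (suc n) h = ≈K-+ (sumN-≈K n (λ i i<n → h i (ℕP.m<n⇒m<1+n i<n))) (h n (ℕP.n<1+n n))

    sumN-minDeg : ∀ {k} n (f : ℕ → Pol N) → (∀ i → i < n → MinDeg k (f i)) → MinDeg k (sumN n f)
    sumN-minDeg zero f h m nq = refl
    sumN-minDeg {k} (suc n) f h =
      degreesIn-+ {Q = k ≤_} (sumN n f) (f n) (sumN-minDeg n f (λ i i<n → h i (ℕP.m<n⇒m<1+n i<n))) (h n (ℕP.n<1+n n))

    dividedPowers : Pol N → Pol N → ℕ → ℕ → Pol N
    dividedPowers p q i j = (invFact i ·P (p ^P i)) *P (invFact j ·P (q ^P j))

    dividedPowers-minDeg : (p q : Pol N) → MinDeg 1 p → MinDeg 1 q → ∀ i j → MinDeg (i ℕ.+ j) (dividedPowers p q i j)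
    dividedPowers-minDeg p q hp hq i j =
      Eq.subst (λ z → MinDeg z (dividedPowers p q i j)) (Eq.cong₂ ℕ._+_ (ℕP.*-identityʳ i) (ℕP.*-identityʳ j))
        (minDeg-* (invFact i ·P (p ^P i)) (invFact j ·P (q ^P j))
          (degreesIn-· {Q = i ℕ.* 1 ≤_} (invFact i) (p ^P i) (minDeg-^ 1 p i hp))
          (degreesIn-· {Q = j ℕ.* 1 ≤_} (invFact j) (q ^P j) (minDeg-^ 1 q j hq)))

    binomial-term : ∀ m k (p q : Pol N) → k ≤ m →
      invFact m ·P (ι (m C k) ·P ((p ^P k) *P (q ^P (m ∸ k)))) ≐ dividedPowers p q k (m ∸ k)
    binomial-term m k p q k≤m = beginP
      invFact m ·P (ι (m C k) ·P ((p ^P k) *P (q ^P (m ∸ k))))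
        ≐⟨ ·-assoc (invFact m) (ι (m C k)) _ ⟩
      (invFact m * ι (m C k)) ·P ((p ^P k) *P (q ^P (m ∸ k)))
        ≐⟨ ·-cong _ (invFact-binom k≤m) ⟩
      (invFact k * invFact (m ∸ k)) ·P ((p ^P k) *P (q ^P (m ∸ k)))
        ≐˘⟨ ·-assoc (invFact k) (invFact (m ∸ k)) _ ⟩
      invFact k ·P (invFact (m ∸ k) ·P ((p ^P k) *P (q ^P (m ∸ k))))
        ≐˘⟨ ·P-cong (invFact k) (·-*ʳ (invFact (m ∸ k)) (p ^P k) (q ^P (m ∸ k))) ⟩
      invFact k ·P ((p ^P k) *P (invFact (m ∸ k) ·P (q ^P (m ∸ k))))
        ≐˘⟨ ·-*ˡ (invFact k) (p ^P k) (invFact (m ∸ k) ·P (q ^P (m ∸ k))) ⟩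
      dividedPowers p q k (m ∸ k) ∎P

    divided-binomial : ∀ m (p q : Pol N) → invFact m ·P ((p +P q) ^P m) ≐ sumN (suc m) (λ k → dividedPowers p q k (m ∸ k))
    divided-binomial m p q = beginP
      invFact m ·P ((p +P q) ^P m)           ≐⟨ ·P-cong (invFact m) (≐-trans (≐-reflexive (Eq.sym (power≡^P m (p +P q)))) (theorem m p q)) ⟩
      invFact m ·P expansion                 ≐⟨ ·P-cong (invFact m) (sumN-fin (suc m) term) ⟩
      invFact m ·P sumN (suc m) term         ≐⟨ ·-as-* (invFact m) (sumN (suc m) term) ⟩
      κ (invFact m) *P sumN (suc m) term     ≐⟨ sumN-*ˡ (suc m) (κ (invFact m)) term ⟩
      sumN (suc m) (λ k → κ (invFact m) *P term k)
                                             ≐⟨ sumN-cong (suc m) (λ k k≤m → normalise k (ℕP.≤-pred k≤m)) ⟩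
      sumN (suc m) (λ k → dividedPowers p q k (m ∸ k)) ∎P
      where
      open CommutativeRing (PolR N) using () renaming (commutativeSemiring to PolSemiring; +-rawMonoid to Pol+; *-rawMonoid to Pol*)
      open Binomial PolSemiring using (theorem)
      open RawMonoid Pol+ using () renaming (_×_ to _×P_)
      expansion : Pol N
      expansion = Binomial.binomialExpansion PolSemiring p q m
      libPow : ℕ → Pol N → Pol N
      libPow = RawMonoid._×_ Pol*
      power≡^P : ∀ m x → libPow m x ≡ x ^P m
      power≡^P zero x = Eq.refl
      power≡^P (suc m) x = Eq.cong (x *P_) (power≡^P m x)
      ×≐ι· : ∀ n (x : Pol N) → n ×P x ≐ ι n ·P x
      ×≐ι· zero x = ≐-sym (·-0 x)
      ×≐ι· (suc n) x = ≐-trans (+P-cong (≐-sym (·-1 x refl)) (×≐ι· n x)) (≐-sym (·-distrib 1# (ι n) x))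
      term : ℕ → Pol N
      term k = (m C k) ×P (libPow k p *P libPow (m ∸ k) q)
      normalise : ∀ k → k ≤ m → κ (invFact m) *P term k ≐ dividedPowers p q k (m ∸ k)
      normalise k k≤m = beginP
        κ (invFact m) *P term k
          ≐⟨ *P-cong (≐-refl {p = κ (invFact m)}) (≐-trans (≐-reflexive (Eq.cong ((m C k) ×P_) (Eq.cong₂ _*P_ (power≡^P k p) (power≡^P (m ∸ k) q))))
                                                          (×≐ι· (m C k) ((p ^P k) *P (q ^P (m ∸ k))))) ⟩
        κ (invFact m) *P (ι (m C k) ·P ((p ^P k) *P (q ^P (m ∸ k))))
          ≐˘⟨ ·-as-* (invFact m) _ ⟩
        invFact m ·P (ι (m C k) ·P ((p ^P k) *P (q ^P (m ∸ k))))
          ≐⟨ binomial-term m k p q k≤m ⟩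
        dividedPowers p q k (m ∸ k) ∎P

    -- Completing a row Σ_{j ≤ n-i} X i j to Σ_{j ≤ n} X i j only adds terms of
    -- degree > n.
    completeRow : ∀ K n (p q : Pol N) → K ≤ n → MinDeg 1 p → MinDeg 1 q → ∀ i → i ≤ n →
      sumN (suc (n ∸ i)) (dividedPowers p q i) ≈[ K ] sumN (suc n) (dividedPowers p q i)
    completeRow K n p q K≤n hp hq i i≤n = beginK
      sumN (suc (n ∸ i)) X                ≐K⟨ ≐-sym (+P-idʳ (sumN (suc (n ∸ i)) X)) ⟩
      sumN (suc (n ∸ i)) X +P []          ≈K⟨ ≈K-+ (≈K-refl {p = sumN (suc (n ∸ i)) X}) (≈K-sym (minDeg⇒≈K0 rest rest-min)) ⟩
      sumN (suc (n ∸ i)) X +P rest        ≐K⟨ ≐-sym (sumN-split (suc (n ∸ i)) i X) ⟩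
      sumN (suc (n ∸ i) ℕ.+ i) X          ≐K⟨ ≐-reflexive (Eq.cong (λ z → sumN z X) length-eq) ⟩
      sumN (suc n) X                      ∎K
      where
      X = dividedPowers p q i
      rest = sumN i (λ j → X (suc (n ∸ i) ℕ.+ j))
      length-eq : suc (n ∸ i) ℕ.+ i ≡ suc n
      length-eq = Eq.cong suc (ℕP.m∸n+n≡m i≤n)
      high : ∀ j → suc K ≤ i ℕ.+ (suc (n ∸ i) ℕ.+ j)
      high j = ℕP.≤-trans (ℕ.s≤s K≤n) (Eq.subst (_≤ i ℕ.+ (suc (n ∸ i) ℕ.+ j))
                 (Eq.trans (ℕP.+-comm i (suc (n ∸ i))) length-eq) (ℕP.+-monoʳ-≤ i (ℕP.m≤m+n (suc (n ∸ i)) j)))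
      rest-min : MinDeg (suc K) rest
      rest-min = sumN-minDeg i _ (λ j _ → minDeg-weaken (high j) (X (suc (n ∸ i) ℕ.+ j))
                                             (dividedPowers-minDeg p q hp hq i (suc (n ∸ i) ℕ.+ j)))

    expT-+ : ∀ K n (p q : Pol N) → K ≤ n → MinDeg 1 p → MinDeg 1 q → expT n (p +P q) ≈[ K ] expT n p *P expT n q
    expT-+ K n p q K≤n hp hq = beginK
      expT n (p +P q)                                             ≐K⟨ sumN-cong (suc n) (λ m _ → divided-binomial m p q) ⟩
      sumN (suc n) (λ m → sumN (suc m) (λ k → X k (m ∸ k)))      ≐K⟨ triangle n X ⟩
      sumN (suc n) (λ i → sumN (suc (n ∸ i)) (X i))              ≈K⟨ sumN-≈K (suc n) (λ i i<sn → completeRow K n p q K≤n hp hq i (ℕP.≤-pred i<sn)) ⟩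
      sumN (suc n) (λ i → sumN (suc n) (X i))                    ≐K⟨ ≐-sym (sumN-prod (suc n) (suc n) _ _) ⟩
      expT n p *P expT n q                                        ∎K
      where X = dividedPowers p q

    expT-small : ∀ K n j (x : Pol N) → 1 ≤ n → K < j ℕ.+ j → MinDeg j x → expT n x ≈[ K ] κ 1# +P x
    expT-small K (suc n') j x 1≤n Kj hx = beginK
      expT (suc n') x                                ≐K⟨ sumN-front (suc n') f ⟩
      f 0 +P sumN (suc n') (λ i → f (suc i))         ≐K⟨ +P-cong (≐-refl {p = f 0}) (sumN-front n' (λ i → f (suc i))) ⟩
      f 0 +P (f 1 +P higher)                         ≈K⟨ ≈K-+ (≐⇒≈K (·-1 (x ^P 0) invFact-0))
                                                              (≈K-+ (≐⇒≈K (≐-trans (·-1 (x ^P 1) invFact-1) (^P-1 x))) (minDeg⇒≈K0 higher higher-min)) ⟩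
      κ 1# +P (x +P [])                              ≐K⟨ +P-cong (≐-refl {p = κ 1#}) (+P-idʳ x) ⟩
      κ 1# +P x                                      ∎K
      where
      f = λ i → invFact i ·P (x ^P i)
      higher = sumN n' (λ i → f (suc (suc i)))
      high : ∀ i → suc K ≤ suc (suc i) ℕ.* j
      high i = ℕP.≤-trans Kj (ℕP.+-monoʳ-≤ j (ℕP.m≤m+n j (i ℕ.* j)))
      higher-min : MinDeg (suc K) higher
      higher-min = sumN-minDeg n' _ (λ i _ → degreesIn-· {Q = suc K ≤_} (invFact (suc (suc i))) (x ^P suc (suc i))
                     (minDeg-weaken (high i) (x ^P suc (suc i)) (minDeg-^ j x (suc (suc i)) hx)))

  mon1 : ℕ → Monomial 1
  mon1 k = k Vec.∷ Vec.[]

  single : Carrier → ℕ → Pol 1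
  single c k = (c , mon1 k) ∷ []

  Y : Pol 1
  Y = single 1# 1

  mdeg-mon1 : ∀ k → mdeg (mon1 k) ≡ k
  mdeg-mon1 k = ℕP.+-identityʳ k

  single-terms : ∀ c k → 1 ≤ k → TermsIn (1 ≤_) (single c k)
  single-terms c k h = Eq.subst (1 ≤_) (Eq.sym (mdeg-mon1 k)) h ∷ []

  single-min : ∀ c k → MinDeg k (single c k)
  single-min c k = termsIn⇒degreesIn {Q = k ≤_} (single c k) (ℕP.≤-reflexive (Eq.sym (mdeg-mon1 k)) ∷ [])

  coeff-single-yes : ∀ c k → coeff (single c k) (mon1 k) ≈ c
  coeff-single-yes c k = coeffT-yes c (mon1 k) (mon1 k) Eq.refl

  coeff-single-no : ∀ c k x → k ≢ x → coeff (single c k) (mon1 x) ≈ 0#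
  coeff-single-no c k x ne = coeffT-no c (mon1 k) (mon1 x) (λ { Eq.refl → ne Eq.refl })

  -- One step of the construction of the truncated logarithm: if exp(lg) agrees
  -- with 1 + Y up to degree K, then with c the coefficient of Y^(K+1) in exp(lg),
  -- the correction lg' = lg - c·Y^(K+1) makes exp(lg') agree with 1 + Y up to
  -- degree K + 1, because exp(lg') ≡ exp(lg)·(1 - c·Y^(K+1)).
  module LogStep (n K : ℕ) (1≤K : 1 ≤ K) (K<n : K < n) (lg : Pol 1) (lg-min : MinDeg 1 lg)
                 (h : expT n lg ≈[ K ] κ 1# +P Y) where
    c : Carrier
    c = coeff (expT n lg) (mon1 (suc K))

    correction : Pol 1
    correction = single (- c) (suc K)

    expT-lg : expT n lg ≈[ suc K ] κ 1# +P (Y +P single c (suc K))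
    expT-lg = agreeUpTo lemma
      where
      rhs = κ 1# +P (Y +P single c (suc K))
      coeff-rhs : ∀ x → coeff rhs (mon1 x) ≈ coeff {1} (κ 1#) (mon1 x) + (coeff Y (mon1 x) + coeff (single c (suc K)) (mon1 x))
      coeff-rhs x = trans (coeff-++ (κ 1#) _ (mon1 x)) (+-congˡ (coeff-++ Y (single c (suc K)) (mon1 x)))
      lemma : ∀ m → mdeg m ≤ suc K → coeff (expT n lg) m ≈ coeff rhs m
      lemma (x Vec.∷ Vec.[]) d with x ℕP.≟ suc K
      ... | yes Eq.refl = sym (begin
        coeff rhs (mon1 (suc K))   ≈⟨ coeff-rhs (suc K) ⟩
        coeff {1} (κ 1#) (mon1 (suc K)) + (coeff Y (mon1 (suc K)) + coeff (single c (suc K)) (mon1 (suc K)))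
                                   ≈⟨ +-cong (coeff-single-no 1# 0 (suc K) (λ ()))
                                             (+-cong (coeff-single-no 1# 1 (suc K) (λ eq → ℕP.<⇒≢ 1≤K (ℕP.suc-injective eq))) (coeff-single-yes c (suc K))) ⟩
        0# + (0# + c)              ≈⟨ trans (+-identityˡ _) (+-identityˡ c) ⟩
        c                          ∎)
      ... | no ne = begin
        coeff (expT n lg) (mon1 x) ≈⟨ coeff≈≤ h (mon1 x) (ℕP.≤-pred (ℕP.≤∧≢⇒< d (λ eq → ne (Eq.trans (Eq.sym (mdeg-mon1 x)) eq)))) ⟩
        coeff (κ 1# +P Y) (mon1 x) ≈⟨ coeff-++ (κ 1#) Y (mon1 x) ⟩
        coeff {1} (κ 1#) (mon1 x) + coeff Y (mon1 x)
                                   ≈⟨ +-congˡ (trans (sym (+-identityʳ _)) (+-congˡ (sym (coeff-single-no c (suc K) x (λ eq → ne (Eq.sym eq)))))) ⟩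
        coeff {1} (κ 1#) (mon1 x) + (coeff Y (mon1 x) + coeff (single c (suc K)) (mon1 x))
                                   ≈⟨ sym (coeff-rhs x) ⟩
        coeff rhs (mon1 x)         ∎

    -- exp(correction) = 1 + correction up to degree K + 1, as 2(K + 1) > K + 1.
    expT-correction : expT n correction ≈[ suc K ] κ 1# +P correction
    expT-correction = expT-small (suc K) n (suc K) correction (ℕP.≤-trans (ℕ.s≤s ℕ.z≤n) K<n)
      (ℕ.s≤s (ℕP.≤-trans (ℕP.m≤m+n (suc K) K) (ℕP.≤-reflexive (Eq.sym (ℕP.+-suc K K)))))
      (single-min (- c) (suc K))

    cancel : (κ 1# +P (Y +P single c (suc K))) *P (κ 1# +P correction) ≈[ suc K ] κ 1# +P Y
    cancel = agreeUpTo coeffs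
      where
      T = correction
      lead = single c (suc K)
      A = κ 1# +P (Y +P lead)
      W = (Y +P lead) *P T
      W-min : MinDeg (suc (suc K)) W
      W-min = minDeg-* {j = 1} {suc K} (Y +P lead) T
                (termsIn⇒degreesIn {Q = 1 ≤_} (Y +P lead) (AllP.++⁺ (single-terms 1# 1 ℕP.≤-refl) (single-terms c (suc K) (ℕ.s≤s ℕ.z≤n))))
                (single-min (- c) (suc K))
      lead+T≈0 : ∀ m → coeff lead m + coeff T m ≈ 0#
      lead+T≈0 m with ≡-dec _≟ℕ_ (mon1 (suc K)) m
      ... | yes _ = trans (+-cong (+-identityʳ c) (+-identityʳ (- c))) (-‿inverseʳ c)
      ... | no _ = +-identityʳ 0#
      regroup : ∀ o y cc t → (o + (y + cc)) + (t + 0#) ≈ (o + y) + (cc + t)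
      regroup = solve 4 (λ o y cc t → (o :+ (y :+ cc)) :+ (t :+ con 0) := (o :+ y) :+ (cc :+ t)) refl
        where open Solver
      coeffs : ∀ m → mdeg m ≤ suc K → coeff (A *P (κ 1# +P T)) m ≈ coeff (κ 1# +P Y) m
      coeffs m d = begin
        coeff (A *P (κ 1# +P T)) m                    ≈⟨ coeff≈ (*P-distribˡ A (κ 1#) T) m ⟩
        coeff ((A *P κ 1#) +P (A *P T)) m             ≈⟨ coeff-++ (A *P κ 1#) (A *P T) m ⟩
        coeff (A *P κ 1#) m + coeff (A *P T) m        ≈⟨ +-cong (coeff≈ (≐-trans (*P-comm A (κ 1#)) (*P-idˡ A)) m)
                                                          (trans (coeff≈ (*P-distribʳ T (κ 1#) (Y +P lead)) m) (coeff-++ (κ 1# *P T) W m)) ⟩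
        coeff A m + (coeff (κ 1# *P T) m + coeff W m) ≈⟨ +-cong (trans (coeff-++ (κ 1#) (Y +P lead) m) (+-congˡ (coeff-++ Y lead m)))
                                                          (+-cong (coeff≈ (*P-idˡ T) m) (W-min m (ℕP.<⇒≱ (ℕ.s≤s d)))) ⟩
        (o + (y + cc)) + (t + 0#)                     ≈⟨ regroup o y cc t ⟩
        (o + y) + (cc + t)                            ≈⟨ +-congˡ (lead+T≈0 m) ⟩
        (o + y) + 0#                                  ≈⟨ +-identityʳ _ ⟩
        o + y                                         ≈⟨ sym (coeff-++ (κ 1#) Y m) ⟩
        coeff (κ 1# +P Y) m                           ∎
        where
        o = coeff {1} (κ 1#) m
        y = coeff Y m
        cc = coeff lead m
        t = coeff T m

    improved : expT n (lg ++ correction) ≈[ suc K ] κ 1# +P Y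
    improved = beginK
      expT n (lg +P correction)                                    ≈K⟨ expT-+ (suc K) n lg correction K<n lg-min
                                                                         (minDeg-weaken (ℕ.s≤s ℕ.z≤n) correction (single-min (- c) (suc K))) ⟩
      expT n lg *P expT n correction                               ≈K⟨ ≈K-* expT-lg expT-correction ⟩
      (κ 1# +P (Y +P single c (suc K))) *P (κ 1# +P correction)    ≈K⟨ cancel ⟩
      κ 1# +P Y                                                    ∎K

  -- The truncated logarithm: a univariate lg without constant term such that
  -- exp(lg) agrees with 1 + Y up to degree K (any 1 ≤ K ≤ n), built by
  -- correcting one degree at a time, starting from lg = Y.
  truncatedLog : ∀ n K → 1 ≤ K → K ≤ n → Σ (Pol 1) λ lg → TermsIn (1 ≤_) lg × (expT n lg ≈[ K ] κ 1# +P Y)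
  truncatedLog n (suc zero) _ 1≤n = Y , single-terms 1# 1 ℕP.≤-refl ,
    expT-small 1 n 1 Y 1≤n ℕP.≤-refl (single-min 1# 1)
  truncatedLog n (suc (suc K)) _ K<n with truncatedLog n (suc K) (ℕ.s≤s ℕ.z≤n) (ℕP.≤-trans (ℕP.n≤1+n _) K<n)
  ... | (lg , lg-terms , h) = lg ++ LogStep.correction n (suc K) (ℕ.s≤s ℕ.z≤n) K<n lg lg-min h
                            , AllP.++⁺ lg-terms (single-terms _ (suc (suc K)) (ℕ.s≤s ℕ.z≤n))
                            , LogStep.improved n (suc K) (ℕ.s≤s ℕ.z≤n) K<n lg lg-min h
    where
    lg-min : MinDeg 1 lg
    lg-min = termsIn⇒degreesIn {Q = 1 ≤_} lg lg-terms

  -- It respects +, ·, *,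
  -- the equality of polynomials and, when R has no constant term, agreement up to
  -- degree K; hence it transports exp(lg(Y)) ≈ 1 + Y to exp(lg(R)) ≈ 1 + R.
  hd : Monomial 1 → ℕ
  hd = Vec.head

  coeff-sumP : ∀ {N} (ps : List (Pol N)) m → coeff (sumP ps) m ≈ sumL ps (λ p → coeff p m)
  coeff-sumP [] m = refl
  coeff-sumP (p ∷ ps) m = trans (coeff-++ p (sumP ps) m) (+-congˡ (coeff-sumP ps m))

  coeff-sumN : ∀ {N} k (h : ℕ → Pol N) m → coeff (PolySum.sumN N k h) m ≈ FieldSum.sumN k (λ i → coeff (h i) m)
  coeff-sumN zero h m = refl
  coeff-sumN (suc k) h m = trans (coeff-++ (PolySum.sumN _ k h) (h k) m) (+-congʳ (coeff-sumN k h m))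

  ^P-+ : ∀ {N} (R : Pol N) i j → R ^P (i ℕ.+ j) ≐ (R ^P i) *P (R ^P j)
  ^P-+ R zero j = ≐-sym (*P-idˡ (R ^P j))
  ^P-+ R (suc i) j = beginP
    R *P (R ^P (i ℕ.+ j))         ≐⟨ *P-cong (≐-refl {p = R}) (^P-+ R i j) ⟩
    R *P ((R ^P i) *P (R ^P j))   ≐˘⟨ *P-assoc R (R ^P i) (R ^P j) ⟩
    (R *P (R ^P i)) *P (R ^P j)   ∎P

  coeff-sumP-*ʳ : ∀ {N} (ps : List (Pol N)) q m → coeff (sumP ps *P q) m ≈ sumL ps (λ p → coeff (p *P q) m)
  coeff-sumP-*ʳ [] q m = refl
  coeff-sumP-*ʳ (p ∷ ps) q m =
    trans (coeff≈ (*P-distribʳ q p (sumP ps)) m) (trans (coeff-++ (p *P q) (sumP ps *P q) m) (+-congˡ (coeff-sumP-*ʳ ps q m)))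

  coeff-*-sumP : ∀ {N} p (qs : List (Pol N)) m → coeff (p *P sumP qs) m ≈ sumL qs (λ q → coeff (p *P q) m)
  coeff-*-sumP p qs m = trans (coeff≈ (*P-comm p (sumP qs)) m) (trans (coeff-sumP-*ʳ qs p m) (sumL-cong qs (λ q → coeff≈ (*P-comm q p) m)))

  module _ {N : ℕ} (R : Pol N) where
    termP : Term 1 → Pol N
    termP t = proj₁ t ·P (R ^P hd (proj₂ t))

    sub : Pol 1 → Pol N
    sub f = sumP (map termP f)

    coeff-sub : ∀ f m → coeff (sub f) m ≈ sumL f (λ t → coeff (termP t) m)
    coeff-sub f m = trans (coeff-sumP (map termP f) m) (sumL-map f termP _)

    sub-++ : ∀ f g → sub (f ++ g) ≐ sub f +P sub g
    sub-++ f g = coeffwise λ m →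
      trans (coeff-sub (f ++ g) m) (trans (sumL-++ f g _) (trans (+-cong (sym (coeff-sub f m)) (sym (coeff-sub g m))) (sym (coeff-++ (sub f) (sub g) m))))

    sub-· : ∀ c f → sub (c ·P f) ≐ c ·P sub f
    sub-· c f = coeffwise λ m → begin
      coeff (sub (c ·P f)) m                   ≈⟨ coeff-sub (c ·P f) m ⟩
      sumL (c ·P f) (λ t → coeff (termP t) m)  ≈⟨ sumL-map f _ _ ⟩
      sumL f (λ t → coeff ((c * proj₁ t) ·P (R ^P hd (proj₂ t))) m)
                                               ≈⟨ sumL-cong f (λ t → coeff≈ (≐-sym (·-assoc c (proj₁ t) (R ^P hd (proj₂ t)))) m) ⟩
      sumL f (λ t → coeff (c ·P termP t) m)    ≈⟨ sumL-cong f (λ t → coeff-· c (termP t) m) ⟩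
      sumL f (λ t → c * coeff (termP t) m)     ≈⟨ sym (sumL-*ˡ f c _) ⟩
      c * sumL f (λ t → coeff (termP t) m)     ≈⟨ *-congˡ (sym (coeff-sub f m)) ⟩
      c * coeff (sub f) m                      ≈⟨ sym (coeff-· c (sub f) m) ⟩
      coeff (c ·P sub f) m                     ∎

    termP-mul : ∀ t u → termP (mulTerm t u) ≐ termP t *P termP u
    termP-mul (c , e Vec.∷ Vec.[]) (d , f Vec.∷ Vec.[]) = beginP
      (c * d) ·P (R ^P (e ℕ.+ f))                     ≐⟨ ·P-cong (c * d) (^P-+ R e f) ⟩
      (c * d) ·P ((R ^P e) *P (R ^P f))               ≐˘⟨ ·-assoc c d ((R ^P e) *P (R ^P f)) ⟩
      c ·P (d ·P ((R ^P e) *P (R ^P f)))              ≐˘⟨ ·P-cong c (·-*ʳ d (R ^P e) (R ^P f)) ⟩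
      c ·P ((R ^P e) *P (d ·P (R ^P f)))              ≐˘⟨ ·-*ˡ c (R ^P e) (d ·P (R ^P f)) ⟩
      (c ·P (R ^P e)) *P (d ·P (R ^P f))              ∎P

    sub-* : ∀ f g → sub (f *P g) ≐ sub f *P sub g
    sub-* f g = coeffwise λ m → begin
      coeff (sub (f *P g)) m                                        ≈⟨ coeff-sub (f *P g) m ⟩
      sumL (f *P g) (λ v → coeff (termP v) m)                       ≈⟨ sumL-concatMap f _ _ ⟩
      sumL f (λ t → sumL (map (mulTerm t) g) (λ v → coeff (termP v) m)) ≈⟨ sumL-cong f (λ t → sumL-map g (mulTerm t) _) ⟩
      sumL f (λ t → sumL g (λ u → coeff (termP (mulTerm t u)) m))   ≈⟨ sumL-cong f (λ t → sumL-cong g (λ u → coeff≈ (termP-mul t u) m)) ⟩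
      sumL f (λ t → sumL g (λ u → coeff (termP t *P termP u) m))    ≈⟨ sumL-cong f (λ t → trans (sym (sumL-map g termP _))
                                                                                          (sym (coeff-*-sumP (termP t) (map termP g) m))) ⟩
      sumL f (λ t → coeff (termP t *P sub g) m)                     ≈⟨ sym (sumL-map f termP _) ⟩
      sumL (map termP f) (λ p → coeff (p *P sub g) m)               ≈⟨ sym (coeff-sumP-*ʳ (map termP f) (sub g) m) ⟩
      coeff (sub f *P sub g) m                                      ∎

    sub-1 : sub (κ 1#) ≐ κ 1#
    sub-1 = coeffwise λ m → trans (coeff-++ (termP (1# , mon1 0)) [] m) (trans (+-identityʳ _) (coeff≈ (·-1 (constP 1#) refl) m))

    sub-Y : sub Y ≐ R
    sub-Y = coeffwise λ m → trans (coeff-++ (termP (1# , mon1 1)) [] m) (trans (+-identityʳ _) (coeff≈ (≐-trans (·-1 (R ^P 1) refl) (^P-1 R)) m))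

    sub-^ : ∀ f i → sub (f ^P i) ≐ sub f ^P i
    sub-^ f zero = sub-1
    sub-^ f (suc i) = ≐-trans (sub-* f (f ^P i)) (*P-cong (≐-refl {p = sub f}) (sub-^ f i))

    sub-sumN : ∀ n (h : ℕ → Pol 1) → sub (PolySum.sumN 1 n h) ≐ PolySum.sumN N n (λ i → sub (h i))
    sub-sumN zero h = ≐-refl
    sub-sumN (suc n) h = ≐-trans (sub-++ (PolySum.sumN 1 n h) (h n)) (+P-cong (sub-sumN n h) (≐-refl {p = sub (h n)}))

    sub-expT : ∀ n f → sub (expT n f) ≐ expT n (sub f)
    sub-expT n f = ≐-trans (sub-sumN (suc n) _)
      (PolySum.sumN-cong N (suc n) (λ i _ → ≐-trans (sub-· (invFact i) (f ^P i)) (·P-cong (invFact i) (sub-^ f i))))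

    -- Normal form: for f of exponents ≤ D, sub R f = Σ_{k≤D} (coeff of Y^k in f)·R^k.
    -- It shows that sub R f depends only on the coefficients of f.
    normalForm : ℕ → Pol 1 → Pol N
    normalForm D f = PolySum.sumN N (suc D) (λ k → coeff f (mon1 k) ·P (R ^P k))

    normalForm-single : ∀ c k₀ D → k₀ ≤ D → normalForm D (single c k₀) ≐ c ·P (R ^P k₀)
    normalForm-single c k₀ D k₀≤D with ℕP.m≤n⇒m<n∨m≡n k₀≤D
    ... | inj₂ Eq.refl = beginP
      PolySum.sumN N k₀ h +P h k₀    ≐⟨ +P-cong (PolySum.sumN-0 N k₀ h (λ i i<k₀ → ≐-trans (·-cong (R ^P i) (coeff-single-no c k₀ i
                                                   (λ eq → ℕP.<⇒≢ i<k₀ (Eq.sym eq)))) (·-0 (R ^P i))))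
                                                (·-cong (R ^P k₀) (coeff-single-yes c k₀)) ⟩
      [] +P (c ·P (R ^P k₀))         ∎P
      where h = λ k → coeff (single c k₀) (mon1 k) ·P (R ^P k)
    ... | inj₁ k₀<D with D
    ...   | suc D' = beginP
      normalForm D' (single c k₀) +P h (suc D') ≐⟨ +P-cong (normalForm-single c k₀ D' (ℕP.≤-pred k₀<D))
                                                         (≐-trans (·-cong (R ^P suc D') (coeff-single-no c k₀ (suc D') (ℕP.<⇒≢ k₀<D))) (·-0 (R ^P suc D'))) ⟩
      (c ·P (R ^P k₀)) +P []                    ≐⟨ +P-idʳ _ ⟩
      c ·P (R ^P k₀)                            ∎P
      where h = λ k → coeff (single c k₀) (mon1 k) ·P (R ^P k)

    maxExp : Pol 1 → ℕ
    maxExp [] = 0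
    maxExp (t ∷ f) = hd (proj₂ t) ⊔ maxExp f

    sub-normalForm : ∀ D f → maxExp f ≤ D → sub f ≐ normalForm D f
    sub-normalForm D [] h = ≐-sym (PolySum.sumN-0 N (suc D) _ (λ i _ → ·-0 (R ^P i)))
    sub-normalForm D ((c , x Vec.∷ Vec.[]) ∷ f) h = beginP
      termP (c , mon1 x) +P sub f
        ≐⟨ +P-cong (≐-sym (normalForm-single c x D (ℕP.m⊔n≤o⇒m≤o x (maxExp f) h))) (sub-normalForm D f (ℕP.m⊔n≤o⇒n≤o x (maxExp f) h)) ⟩
      normalForm D (single c x) +P normalForm D f
        ≐˘⟨ PolySum.sumN-+ N (suc D) _ _ ⟩
      PolySum.sumN N (suc D) (λ k → (coeff (single c x) (mon1 k) ·P (R ^P k)) +P (coeff f (mon1 k) ·P (R ^P k)))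
        ≐⟨ PolySum.sumN-cong N (suc D) (λ k _ → ≐-trans (≐-sym (·-distrib _ _ (R ^P k))) (·-cong (R ^P k) (sym (coeff-∷ (c , mon1 x) f (mon1 k))))) ⟩
      normalForm D ((c , mon1 x) ∷ f) ∎P

    sub-cong : ∀ {f g} → f ≐ g → sub f ≐ sub g
    sub-cong {f} {g} h = beginP
      sub f            ≐⟨ sub-normalForm D f (ℕP.m≤m⊔n _ _) ⟩
      normalForm D f   ≐⟨ PolySum.sumN-cong N (suc D) (λ k _ → ·-cong (R ^P k) (coeff≈ h (mon1 k))) ⟩
      normalForm D g   ≐˘⟨ sub-normalForm D g (ℕP.m≤n⊔m _ _) ⟩
      sub g            ∎P
      where D = maxExp f ⊔ maxExp g

    module _ (R-min : MinDeg 1 R) where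
      sub-minDeg : ∀ k f → TermsIn (k ≤_) f → MinDeg k (sub f)
      sub-minDeg k [] h m nq = refl
      sub-minDeg k ((c , x Vec.∷ Vec.[]) ∷ f) (hk ∷ h) = degreesIn-+ {Q = k ≤_} (termP (c , mon1 x)) (sub f)
        (degreesIn-· {Q = k ≤_} c (R ^P x)
          (minDeg-weaken (Eq.subst (k ≤_) (Eq.trans (mdeg-mon1 x) (Eq.sym (ℕP.*-identityʳ x))) hk) (R ^P x) (minDeg-^ 1 R x R-min)))
        (sub-minDeg k f h)

      sub-≈K : ∀ {K} {f g} → f ≈[ K ] g → sub f ≈[ K ] sub g
      sub-≈K {K} {f} {g} h = minDeg⇒≈K (degreesIn-≐ {Q = suc K ≤_} same (sub-minDeg (suc K) high (filterDeg-terms (suc K ℕ.≤?_) δ)))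
        where
        δ = f +P negP g
        high = filterDeg (suc K ℕ.≤?_) δ
        same : sub high ≐ sub f +P negP (sub g)
        same = beginP
          sub high                 ≐⟨ sub-cong (≐-sym (degreesIn⇒filterDeg (suc K ℕ.≤?_) δ (≈K⇒minDeg h))) ⟩
          sub δ                    ≐⟨ sub-++ f (negP g) ⟩
          sub f +P sub (negP g)    ≐⟨ +P-cong (≐-refl {p = sub f}) (sub-· (- 1#) g) ⟩
          sub f +P negP (sub g)    ∎P

      expT-log : ∀ n (lg : Pol 1) → expT n lg ≈[ n ] κ 1# +P Y → expT n (sub lg) ≈[ n ] κ 1# +P R
      expT-log n lg hlg = beginK
        expT n (sub lg)        ≐K⟨ ≐-sym (sub-expT n lg) ⟩
        sub (expT n lg)        ≈K⟨ sub-≈K hlg ⟩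
        sub (κ 1# +P Y)        ≐K⟨ sub-++ (κ 1#) Y ⟩
        sub (κ 1#) +P sub Y    ≐K⟨ +P-cong sub-1 sub-Y ⟩
        κ 1# +P R              ∎K

  sum-Hom-below : ∀ {N} (X : Pol N) m n → mdeg m < n → sumL (downFrom n) (λ e → coeff (Hom e X) m) ≈ coeff X m
  sum-Hom-above : ∀ {N} (X : Pol N) m n → n ≤ mdeg m → sumL (downFrom n) (λ e → coeff (Hom e X) m) ≈ 0#
  sum-Hom-below X m (suc n) lt with mdeg m ℕ.≟ n
  ... | yes eq = trans (+-cong (filterDeg-in (ℕ._≟ n) X m eq) (sum-Hom-above X m n (ℕP.≤-reflexive (Eq.sym eq)))) (+-identityʳ _)
  ... | no ne = trans (+-cong (filterDeg-out (ℕ._≟ n) X m ne) (sum-Hom-below X m n (ℕP.≤∧≢⇒< (ℕP.≤-pred lt) ne))) (+-identityˡ _)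
  sum-Hom-above X m zero ge = refl
  sum-Hom-above X m (suc n) ge =
    trans (+-cong (filterDeg-out (ℕ._≟ n) X m (λ eq → ℕP.<⇒≢ ge (Eq.sym eq))) (sum-Hom-above X m n (ℕP.≤-trans (ℕP.n≤1+n n) ge)))
          (+-identityˡ 0#)

  sum-Hom : ∀ {N} (X : Pol N) n m → sumL (downFrom (suc n)) (λ e → coeff (Hom e X) m) ≈ coeff (HomLe n X) m
  sum-Hom X n m with mdeg m ℕ.≤? n
  ... | yes le = trans (sum-Hom-below X m (suc n) (ℕ.s≤s le)) (sym (filterDeg-in (ℕ._≤? n) X m le))
  ... | no gt = trans (sum-Hom-above X m (suc n) (ℕP.≰⇒> gt)) (sym (filterDeg-out (ℕ._≤? n) X m gt))

  coeff-evalSum3 : ∀ {N} (g : SumGate3 N) m → coeff (evalSum3 g) m ≈ sumL g (λ u → proj₁ u * coeff (evalPow (proj₂ u)) m)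
  coeff-evalSum3 g m = trans (coeff-sumP (map (λ t → proj₁ t ·P evalPow (proj₂ t)) g) m)
    (trans (sumL-map g _ _) (sumL-cong g (λ u → coeff-· (proj₁ u) (evalPow (proj₂ u)) m)))

  evalSum3-++ : ∀ {N} (g h : SumGate3 N) → evalSum3 (g ++ h) ≐ evalSum3 g +P evalSum3 h
  evalSum3-++ g h = coeffwise λ m → trans (coeff-evalSum3 (g ++ h) m)
    (trans (sumL-++ g h _) (trans (+-cong (sym (coeff-evalSum3 g m)) (sym (coeff-evalSum3 h m))) (sym (coeff-++ (evalSum3 g) (evalSum3 h) m))))

  coeff-evalSum3-concatMap : ∀ {b N} {X : Set b} (f : X → SumGate3 N) xs m →
    coeff (evalSum3 (concatMap f xs)) m ≈ sumL xs (λ x → coeff (evalSum3 (f x)) m)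
  coeff-evalSum3-concatMap f xs m = begin
    coeff (evalSum3 (concatMap f xs)) m                   ≈⟨ coeff-evalSum3 (concatMap f xs) m ⟩
    sumL (concatMap f xs) G                               ≈⟨ sumL-concatMap xs f G ⟩
    sumL xs (λ x → sumL (f x) G)                          ≈⟨ sumL-cong xs (λ x → sym (coeff-evalSum3 (f x) m)) ⟩
    sumL xs (λ x → coeff (evalSum3 (f x)) m)              ∎
    where G = λ (u : Carrier × PowGate _) → proj₁ u * coeff (evalPow (proj₂ u)) m

  powerGate : ∀ {N} → Carrier → ℕ → Pol N → Scalings → SumGate3 N
  powerGate c k R os = map (λ o → (c * proj₁ o , (k , scaleVars (proj₂ o) R))) os

  coeff-powerGate : ∀ {N} c k (R : Pol N) os m → coeff (evalSum3 (powerGate c k R os)) m ≈ c * coeff (applyScalings os (R ^P k)) m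
  coeff-powerGate c k R os m = begin
    coeff (evalSum3 (powerGate c k R os)) m
      ≈⟨ coeff-evalSum3 (powerGate c k R os) m ⟩
    sumL (powerGate c k R os) (λ u → proj₁ u * coeff (evalPow (proj₂ u)) m)
      ≈⟨ sumL-map os _ _ ⟩
    sumL os (λ o → (c * proj₁ o) * coeff (scaleVars (proj₂ o) R ^P k) m)
      ≈⟨ sumL-cong os (λ o → *-congˡ (trans (sym (coeff≈ (scaleVars-^ (proj₂ o) R k) m)) (coeff-scale (proj₂ o) (R ^P k) m))) ⟩
    sumL os (λ o → (c * proj₁ o) * (proj₂ o ^F mdeg m * coeff (R ^P k) m))
      ≈⟨ sumL-cong os (λ o → regroup c (proj₁ o) _ _) ⟩
    sumL os (λ o → c * ((proj₁ o * proj₂ o ^F mdeg m) * coeff (R ^P k) m))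
      ≈⟨ sym (sumL-*ˡ os c _) ⟩
    c * sumL os (λ o → (proj₁ o * proj₂ o ^F mdeg m) * coeff (R ^P k) m)
      ≈⟨ *-congˡ (sym (sumL-*ʳ os _ _)) ⟩
    c * (multiplier os (mdeg m) * coeff (R ^P k) m)
      ≈⟨ *-congˡ (sym (coeff-applyScalings os (R ^P k) m)) ⟩
    c * coeff (applyScalings os (R ^P k)) m ∎
    where
    open Solver
    regroup : ∀ c w s x → (c * w) * (s * x) ≈ c * ((w * s) * x)
    regroup = solve 4 (λ c w s x → (c :* w) :* (s :* x) := c :* ((w :* s) :* x)) refl

  -- The Σ∧ gate computing c · HomLe n (R^k): one block of scalings per degree
  -- e ≤ n, extracting Hom e (R^k) (which has degree ≤ k · maxdeg R).
  truncPowerGate : ∀ {N} → ℕ → Carrier → ℕ → Pol N → SumGate3 N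
  truncPowerGate n c k R = concatMap (λ e → powerGate c k R (extractor (k ℕ.* maxdeg R) e)) (downFrom (suc n))

  eval-truncPowerGate : ∀ {N} n c k (R : Pol N) → evalSum3 (truncPowerGate n c k R) ≐ c ·P HomLe n (R ^P k)
  eval-truncPowerGate n c k R = coeffwise λ m → begin
    coeff (evalSum3 (truncPowerGate n c k R)) m
      ≈⟨ coeff-evalSum3-concatMap (λ e → powerGate c k R (extractor D e)) (downFrom (suc n)) m ⟩
    sumL (downFrom (suc n)) (λ e → coeff (evalSum3 (powerGate c k R (extractor D e))) m)
      ≈⟨ sumL-cong (downFrom (suc n)) (λ e → trans (coeff-powerGate c k R (extractor D e) m)
                                                   (*-congˡ (coeff≈ (extract D e (R ^P k) deg-bound) m))) ⟩
    sumL (downFrom (suc n)) (λ e → c * coeff (Hom e (R ^P k)) m)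
      ≈⟨ sym (sumL-*ˡ (downFrom (suc n)) c _) ⟩
    c * sumL (downFrom (suc n)) (λ e → coeff (Hom e (R ^P k)) m)
      ≈⟨ *-congˡ (sum-Hom (R ^P k) n m) ⟩
    c * coeff (HomLe n (R ^P k)) m
      ≈⟨ sym (coeff-· c (HomLe n (R ^P k)) m) ⟩
    coeff (c ·P HomLe n (R ^P k)) m ∎
    where
    D = k ℕ.* maxdeg R
    deg-bound : MaxDeg D (R ^P k)
    deg-bound = maxDeg-^ (maxdeg R) R k (maxdeg-bound R)

  truncGate : ∀ {N} → ℕ → Pol 1 → Pol N → SumGate3 N
  truncGate n lg R = concatMap (λ t → truncPowerGate n (proj₁ t) (hd (proj₂ t)) R) lg

  eval-truncGate : ∀ {N} n lg (R : Pol N) → evalSum3 (truncGate n lg R) ≐ HomLe n (sub R lg)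
  eval-truncGate n lg R = coeffwise λ m → begin
    coeff (evalSum3 (truncGate n lg R)) m
      ≈⟨ coeff-evalSum3-concatMap (λ t → truncPowerGate n (proj₁ t) (hd (proj₂ t)) R) lg m ⟩
    sumL lg (λ t → coeff (evalSum3 (truncPowerGate n (proj₁ t) (hd (proj₂ t)) R)) m)
      ≈⟨ sumL-cong lg (λ t → trans (coeff≈ (eval-truncPowerGate n (proj₁ t) (hd (proj₂ t)) R) m) (coeff-· (proj₁ t) (HomLe n (R ^P hd (proj₂ t))) m)) ⟩
    sumL lg (λ t → proj₁ t * coeff (HomLe n (R ^P hd (proj₂ t))) m)
      ≈⟨ truncate m (mdeg m ℕ.≤? n) ⟩
    coeff (HomLe n (sub R lg)) m ∎
    where
    truncate : ∀ m → Dec (mdeg m ≤ n) → sumL lg (λ t → proj₁ t * coeff (HomLe n (R ^P hd (proj₂ t))) m) ≈ coeff (HomLe n (sub R lg)) m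
    truncate m (yes le) =
      trans (sumL-cong lg (λ t → trans (*-congˡ (filterDeg-in (ℕ._≤? n) (R ^P hd (proj₂ t)) m le)) (sym (coeff-· (proj₁ t) (R ^P hd (proj₂ t)) m))))
            (trans (sym (coeff-sub R lg m)) (sym (filterDeg-in (ℕ._≤? n) (sub R lg) m le)))
    truncate m (no gt) =
      trans (sumL-0 lg _ (λ t → trans (*-congˡ (filterDeg-out (ℕ._≤? n) (R ^P hd (proj₂ t)) m gt)) (zeroʳ _)))
            (sym (filterDeg-out (ℕ._≤? n) (sub R lg) m gt))

  SiblingEntry : ∀ {N} → Pol N → Carrier × PowGate N → Set (a Level.⊔ ℓ)
  SiblingEntry R u = Σ Carrier λ σ → Nonzero σ × (proj₂ (proj₂ u) ≡ scaleVars σ R)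

  truncGate-siblings : ∀ {N} n lg (R : Pol N) → All (SiblingEntry R) (truncGate n lg R)
  truncGate-siblings n lg R =
    AllP.concat⁺ (AllP.map⁺ (All.universal (λ t → AllP.concat⁺ (AllP.map⁺ (All.universal (λ e →
      powerGate-siblings (proj₁ t) (hd (proj₂ t)) _ (extractor-nonzero (hd (proj₂ t) ℕ.* maxdeg R) e)) (downFrom (suc n))))) lg))
    where
    powerGate-siblings : ∀ c k os → All (λ o → Nonzero (proj₂ o)) os → All (SiblingEntry R) (powerGate c k R os)
    powerGate-siblings c k os nz = AllP.map⁺ (All.map (λ {o} σ≉0 → proj₂ o , σ≉0 , Eq.refl) nz)

  prodP-++ : ∀ {N} (xs ys : List (Pol N)) → prodP (xs ++ ys) ≐ prodP xs *P prodP ys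
  prodP-++ [] ys = ≐-sym (*P-idˡ (prodP ys))
  prodP-++ (x ∷ xs) ys = ≐-trans (*P-cong (≐-refl {p = x}) (prodP-++ xs ys)) (≐-sym (*P-assoc x (prodP xs) (prodP ys)))

  prodP-≈K : ∀ {N K b} {X : Set b} (xs : List X) (f g : X → Pol N) → (∀ x → f x ≈[ K ] g x) → prodP (map f xs) ≈[ K ] prodP (map g xs)
  prodP-≈K [] f g h = ≈K-refl
  prodP-≈K (x ∷ xs) f g h = ≈K-* (h x) (prodP-≈K xs f g h)

  prodP-replicate : ∀ {N} k (x : Pol N) → prodP (List.replicate k x) ≡ x ^P k
  prodP-replicate zero x = Eq.refl
  prodP-replicate (suc k) x = Eq.cong (x *P_) (prodP-replicate k x)

  prodP-maxDeg : ∀ {N} n (ps : List (Pol N)) → All (MaxDeg n) ps → MaxDeg (length ps ℕ.* n) (prodP ps)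
  prodP-maxDeg n [] [] = maxDeg-const1
  prodP-maxDeg n (p ∷ ps) (h ∷ hs) = maxDeg-* p (prodP ps) h (prodP-maxDeg n ps hs)

  prodP-minDeg : ∀ {N} (ps : List (Pol N)) → All (MinDeg 1) ps → MinDeg (length ps) (prodP ps)
  prodP-minDeg [] [] = minDeg-0 (constP 1#)
  prodP-minDeg (p ∷ ps) (h ∷ hs) = minDeg-* p (prodP ps) h (prodP-minDeg ps hs)

  sumP-minDeg : ∀ {N} (ps : List (Pol N)) → All (MinDeg 1) ps → MinDeg 1 (sumP ps)
  sumP-minDeg [] [] m nq = refl
  sumP-minDeg (p ∷ ps) (h ∷ hs) = degreesIn-+ {Q = 1 ≤_} p (sumP ps) h (sumP-minDeg ps hs)

  length-concatMap≤ : ∀ {b c} {X : Set b} {Y : Set c} (f : X → List Y) B (xs : List X) →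
    (∀ x → length (f x) ≤ B) → length (concatMap f xs) ≤ length xs ℕ.* B
  length-concatMap≤ f B [] h = ℕ.z≤n
  length-concatMap≤ f B (x ∷ xs) h =
    ℕP.≤-trans (ℕP.≤-reflexive (LP.length-++ (f x))) (ℕP.+-mono-≤ (h x) (length-concatMap≤ f B xs h))

  coeff-eval : ∀ {N} (circ : Circuit N) m → coeff (eval circ) m ≈ sumL circ (λ t → proj₁ t * coeff (evalProd2 (proj₂ t)) m)
  coeff-eval circ m = trans (coeff-sumP (map (λ t → proj₁ t ·P evalProd2 (proj₂ t)) circ) m)
    (trans (sumL-map circ _ _) (sumL-cong circ (λ t → coeff-· (proj₁ t) (evalProd2 (proj₂ t)) m)))

  scaleGate : ∀ {N} → Carrier → SumGate3 N → SumGate3 N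
  scaleGate σ g = map (λ u → (proj₁ u , (proj₁ (proj₂ u) , scaleVars σ (proj₂ (proj₂ u))))) g

  eval-scaleGate : ∀ {N} σ (g : SumGate3 N) → evalSum3 (scaleGate σ g) ≐ scaleVars σ (evalSum3 g)
  eval-scaleGate σ g = coeffwise λ m → begin
    coeff (evalSum3 (scaleGate σ g)) m
      ≈⟨ coeff-evalSum3 (scaleGate σ g) m ⟩
    sumL (scaleGate σ g) (λ u → proj₁ u * coeff (evalPow (proj₂ u)) m)
      ≈⟨ sumL-map g _ _ ⟩
    sumL g (λ u → proj₁ u * coeff (scaleVars σ (proj₂ (proj₂ u)) ^P proj₁ (proj₂ u)) m)
      ≈⟨ sumL-cong g (λ u → *-congˡ (trans (sym (coeff≈ (scaleVars-^ σ (proj₂ (proj₂ u)) (proj₁ (proj₂ u))) m)) (coeff-scale σ (evalPow (proj₂ u)) m))) ⟩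
    sumL g (λ u → proj₁ u * (σ ^F mdeg m * coeff (evalPow (proj₂ u)) m))
      ≈⟨ sumL-cong g (λ u → *-leftSwap _ _ _) ⟩
    sumL g (λ u → σ ^F mdeg m * (proj₁ u * coeff (evalPow (proj₂ u)) m))
      ≈⟨ sym (sumL-*ˡ g _ _) ⟩
    σ ^F mdeg m * sumL g (λ u → proj₁ u * coeff (evalPow (proj₂ u)) m)
      ≈⟨ *-congˡ (sym (coeff-evalSum3 g m)) ⟩
    σ ^F mdeg m * coeff (evalSum3 g) m
      ≈⟨ sym (coeff-scale σ (evalSum3 g) m) ⟩
    coeff (scaleVars σ (evalSum3 g)) m ∎

  eval-scaleProd : ∀ {N} σ (gs : ProdGate2 N) → evalProd2 (map (scaleGate σ) gs) ≐ scaleVars σ (evalProd2 gs)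
  eval-scaleProd σ [] = ≐-sym (scaleVars-1 σ)
  eval-scaleProd σ (g ∷ gs) = ≐-trans (*P-cong (eval-scaleGate σ g) (eval-scaleProd σ gs)) (≐-sym (scaleVars-* σ (evalSum3 g) (evalProd2 gs)))

  scaledProducts : ∀ {N} → Scalings → Carrier → ProdGate2 N → Circuit N
  scaledProducts os c gs = map (λ o → (c * proj₁ o , map (scaleGate (proj₂ o)) gs)) os

  coeff-scaledProducts : ∀ {N} (os : Scalings) c (gs : ProdGate2 N) m →
    coeff (eval (scaledProducts os c gs)) m ≈ c * coeff (applyScalings os (evalProd2 gs)) m
  coeff-scaledProducts os c gs m = begin
    coeff (eval (scaledProducts os c gs)) m
      ≈⟨ coeff-eval (scaledProducts os c gs) m ⟩
    sumL (scaledProducts os c gs) (λ t → proj₁ t * coeff (evalProd2 (proj₂ t)) m)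
      ≈⟨ sumL-map os _ _ ⟩
    sumL os (λ o → (c * proj₁ o) * coeff (evalProd2 (map (scaleGate (proj₂ o)) gs)) m)
      ≈⟨ sumL-cong os (λ o → *-congˡ (trans (coeff≈ (eval-scaleProd (proj₂ o) gs) m) (coeff-scale (proj₂ o) (evalProd2 gs) m))) ⟩
    sumL os (λ o → (c * proj₁ o) * (proj₂ o ^F mdeg m * coeff (evalProd2 gs) m))
      ≈⟨ sumL-cong os (λ o → regroup c (proj₁ o) _ _) ⟩
    sumL os (λ o → c * ((proj₁ o * proj₂ o ^F mdeg m) * coeff (evalProd2 gs) m))
      ≈⟨ sym (sumL-*ˡ os c _) ⟩
    c * sumL os (λ o → (proj₁ o * proj₂ o ^F mdeg m) * coeff (evalProd2 gs) m)
      ≈⟨ *-congˡ (sym (sumL-*ʳ os _ _)) ⟩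
    c * (multiplier os (mdeg m) * coeff (evalProd2 gs) m)
      ≈⟨ *-congˡ (sym (coeff-applyScalings os (evalProd2 gs) m)) ⟩
    c * coeff (applyScalings os (evalProd2 gs)) m ∎
    where
    open Solver
    regroup : ∀ c w s x → (c * w) * (s * x) ≈ c * ((w * s) * x)
    regroup = solve 4 (λ c w s x → (c :* w) :* (s :* x) := c :* ((w :* s) :* x)) refl

  isConstMon-true : ∀ {N} (e : Monomial N) → isConstMon e ≡ true → e ≡ 0v
  isConstMon-true Vec.[] h = Eq.refl
  isConstMon-true (zero Vec.∷ e) h = Eq.cong (0 Vec.∷_) (isConstMon-true e h)

  isConstMon-false : ∀ {N} (e : Monomial N) → isConstMon e ≡ false → 1 ≤ mdeg e
  isConstMon-false (zero Vec.∷ e) h = isConstMon-false e h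
  isConstMon-false (suc x Vec.∷ e) h = ℕ.s≤s ℕ.z≤n

  Hom≥1-min : ∀ {N} (Q : Pol N) → MinDeg 1 (Hom≥1 Q)
  Hom≥1-min Q = termsIn⇒degreesIn {Q = 1 ≤_} (Hom≥1 Q) (terms Q)
    where
    terms : ∀ Q → TermsIn (1 ≤_) (Hom≥1 Q)
    terms [] = []
    terms ((c , e) ∷ Q) with isConstMon e in eq
    ... | true = terms Q
    ... | false = isConstMon-false e eq ∷ terms Q

  coeff-Hom≥1 : ∀ {N} (Q : Pol N) m → m ≢ 0v → coeff (Hom≥1 Q) m ≈ coeff Q m
  coeff-Hom≥1 [] m ne = refl
  coeff-Hom≥1 ((c , e) ∷ Q) m ne with isConstMon e in eq
  ... | true = begin
    coeff (Hom≥1 Q) m            ≈⟨ coeff-Hom≥1 Q m ne ⟩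
    coeff Q m                    ≈⟨ sym (+-identityˡ _) ⟩
    0# + coeff Q m               ≈⟨ +-congʳ (sym (coeffT-no c e m (λ em → ne (Eq.trans (Eq.sym em) (isConstMon-true e eq))))) ⟩
    coeffT (c , e) m + coeff Q m ≈⟨ sym (coeff-∷ (c , e) Q m) ⟩
    coeff ((c , e) ∷ Q) m        ∎
  ... | false = trans (coeff-∷ (c , e) (Hom≥1 Q) m) (trans (+-congˡ (coeff-Hom≥1 Q m ne)) (sym (coeff-∷ (c , e) Q m)))

  constant-split : ∀ {N} (Q : Pol N) → Q ≐ κ (constTerm Q) +P Hom≥1 Q
  constant-split {N} Q = coeffwise λ m → trans (lemma m (≡-dec _≟ℕ_ 0v m)) (sym (coeff-++ (κ (constTerm Q)) (Hom≥1 Q) m))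
    where
    no-constant : coeff (Hom≥1 Q) 0v ≈ 0#
    no-constant = Hom≥1-min Q 0v (λ h → ℕP.<⇒≱ (ℕ.s≤s ℕ.z≤n) (ℕP.≤-trans h (ℕP.≤-reflexive (mdeg-0 {N}))))
    lemma : ∀ m → Dec (0v ≡ m) → coeff Q m ≈ coeff (κ (constTerm Q)) m + coeff (Hom≥1 Q) m
    lemma m (yes Eq.refl) = trans (sym (+-identityʳ _)) (+-cong (sym (coeffT-yes (constTerm Q) (0v {N}) 0v Eq.refl)) (sym no-constant))
    lemma m (no ne) = trans (sym (coeff-Hom≥1 Q m (λ eq → ne (Eq.sym eq))))
                            (trans (sym (+-identityˡ _)) (+-congʳ (sym (coeffT-no (constTerm Q) 0v m ne))))

  module ProductCircuit {N : ℕ} (n : ℕ) (lg : Pol 1) (lg-terms : TermsIn (1 ≤_) lg) (lg-log : expT n lg ≈[ n ] κ 1# +P Y)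
                        {d : ℕ} (Q : Fin d → Pol N) (hc : ∀ j → (constTerm (Q j) ≈ 0#) ⊎ (constTerm (Q j) ≈ 1#)) (α : Carrier) where

    constantZero : Fin d → Bool
    constantZero j = [ (λ _ → true) , (λ _ → false) ]′ (hc j)

    R : Fin d → Pol N
    R j = Hom≥1 (Q j)

    R-min : ∀ j → MinDeg 1 (R j)
    R-min j = Hom≥1-min (Q j)

    Q-zero : ∀ j → constantZero j ≡ true → Q j ≐ R j
    Q-zero j h with hc j
    ... | inj₁ c≈0 = ≐-trans (constant-split (Q j)) (+P-cong (≐-trans (κ-cong c≈0) κ-0) (≐-refl {p = R j}))

    Q-one : ∀ j → constantZero j ≡ false → Q j ≐ κ 1# +P R j
    Q-one j h with hc j
    ... | inj₂ c≈1 = ≐-trans (constant-split (Q j)) (+P-cong (κ-cong c≈1) (≐-refl {p = R j}))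

    Z U : List (Fin d)
    Z = List.filterᵇ constantZero (List.allFin d)
    U = List.filterᵇ (λ j → not (constantZero j)) (List.allFin d)

    z : ℕ
    z = length Z

    P-Z P-U : Pol N
    P-Z = prodP (map R Z)
    P-U = prodP (map (λ j → κ 1# +P R j) U)

    product-split : ΠF d Q ≐ P-Z *P P-U
    product-split = ≐-trans (≐-reflexive (Eq.cong prodP (Eq.sym (LP.map-tabulate (λ j → j) Q)))) (split (List.allFin d))
      where
      PZ PU : List (Fin d) → Pol N
      PZ xs = prodP (map R (List.filterᵇ constantZero xs))
      PU xs = prodP (map (λ j → κ 1# +P R j) (List.filterᵇ (λ j → not (constantZero j)) xs))
      split : ∀ xs → prodP (map Q xs) ≐ PZ xs *P PU xs
      split [] = ≐-sym (*P-idˡ (constP 1#))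
      split (x ∷ xs) with constantZero x in eq
      ... | true = beginP
        Q x *P prodP (map Q xs)     ≐⟨ *P-cong (Q-zero x eq) (split xs) ⟩
        R x *P (PZ xs *P PU xs)     ≐˘⟨ *P-assoc (R x) (PZ xs) (PU xs) ⟩
        (R x *P PZ xs) *P PU xs     ∎P
      ... | false = beginP
        Q x *P prodP (map Q xs)     ≐⟨ *P-cong (Q-one x eq) (split xs) ⟩
        Sx *P (PZ xs *P PU xs)       ≐˘⟨ *P-assoc Sx (PZ xs) (PU xs) ⟩
        (Sx *P PZ xs) *P PU xs       ≐⟨ *P-congʳ (PU xs) (*P-comm Sx (PZ xs)) ⟩
        (PZ xs *P Sx) *P PU xs       ≐⟨ *P-assoc (PZ xs) Sx (PU xs) ⟩
        PZ xs *P (Sx *P PU xs)       ∎P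
        where Sx = κ 1# +P R x

    P-Z-min : MinDeg z P-Z
    P-Z-min = Eq.subst (λ w → MinDeg w P-Z) (LP.length-map R Z) (prodP-minDeg (map R Z) (AllP.map⁺ (All.universal R-min Z)))

    -- L = Σ_{j∈U} lg(Rⱼ), so that exp(L) ≈ P_U up to degree n.
    L : Pol N
    L = sumP (map (λ j → sub (R j) lg) U)

    -- Each lg(Rⱼ) has no constant term, and exp(Σ_{j∈xs} lg(Rⱼ)) ≈ Π_{j∈xs} (1 + Rⱼ)
    -- up to degree n, by exp(a + b) ≈ exp(a)·exp(b) and exp(lg(Rⱼ)) ≈ 1 + Rⱼ.
    lgR-min : ∀ j → MinDeg 1 (sub (R j) lg)
    lgR-min j = sub-minDeg (R j) (R-min j) 1 lg lg-terms

    sumLgR-min : ∀ xs → MinDeg 1 (sumP (map (λ j → sub (R j) lg) xs))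
    sumLgR-min xs = sumP-minDeg (map (λ j → sub (R j) lg) xs) (AllP.map⁺ (All.universal lgR-min xs))

    expT-sumLgR : ∀ xs → expT n (sumP (map (λ j → sub (R j) lg) xs)) ≈[ n ] prodP (map (λ j → κ 1# +P R j) xs)
    expT-sumLgR [] = ≐⇒≈K (expT-0 n)
    expT-sumLgR (j ∷ xs) = beginK
      expT n (sub (R j) lg +P rest)              ≈K⟨ expT-+ n n (sub (R j) lg) rest ℕP.≤-refl (lgR-min j) (sumLgR-min xs) ⟩
      expT n (sub (R j) lg) *P expT n rest       ≈K⟨ ≈K-* (expT-log (R j) (R-min j) n lg lg-log) (expT-sumLgR xs) ⟩
      (κ 1# +P R j) *P prodP (map (λ j → κ 1# +P R j) xs) ∎K
      where rest = sumP (map (λ j → sub (R j) lg) xs)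

    expT-L : expT n L ≈[ n ] P-U
    expT-L = expT-sumLgR U

    X : ℕ → Pol N
    X k = P-Z *P (L ^P k)

    X-min : ∀ k → MinDeg (z ℕ.+ k) (X k)
    X-min k = minDeg-* P-Z (L ^P k) P-Z-min (Eq.subst (λ w → MinDeg w (L ^P k)) (ℕP.*-identityʳ k) (minDeg-^ 1 L k (sumLgR-min U)))

    -- In degree n: Πⱼ Qⱼ = Σ_{k ≤ n - z} X k / k!, the terms with k > n - z
    -- having degree > n.
    degree-n-expansion : z ≤ n → ∀ m → mdeg m ≡ n →
      coeff (ΠF d Q) m ≈ FieldSum.sumN (suc (n ∸ z)) (λ k → invFact k * coeff (X k) m)
    degree-n-expansion fits m deg = begin
      coeff (ΠF d Q) m                             ≈⟨ coeff≈ product-split m ⟩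
      coeff (P-Z *P P-U) m                         ≈⟨ coeff≈≤ (≈K-* (≈K-refl {p = P-Z}) (≈K-sym expT-L)) m (ℕP.≤-reflexive deg) ⟩
      coeff (P-Z *P expT n L) m                    ≈⟨ coeff≈ expansion m ⟩
      coeff (PolySum.sumN N (suc n) (λ k → invFact k ·P X k)) m
                                                   ≈⟨ coeff-sumN (suc n) (λ k → invFact k ·P X k) m ⟩
      FieldSum.sumN (suc n) (λ k → coeff (invFact k ·P X k) m)
                                                   ≈⟨ FieldSum.sumN-cong (suc n) (λ k _ → coeff-· (invFact k) (X k) m) ⟩
      FieldSum.sumN (suc n) h                      ≡⟨ Eq.cong (λ w → FieldSum.sumN w h) (Eq.sym range) ⟩
      FieldSum.sumN (suc (n ∸ z) ℕ.+ z) h          ≈⟨ FieldSum.sumN-split (suc (n ∸ z)) z h ⟩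
      FieldSum.sumN (suc (n ∸ z)) h + FieldSum.sumN z (λ j → h (suc (n ∸ z) ℕ.+ j))
                                                   ≈⟨ +-congˡ (FieldSum.sumN-0 z _ (λ j _ → high-vanishes j)) ⟩
      FieldSum.sumN (suc (n ∸ z)) h + 0#           ≈⟨ +-identityʳ _ ⟩
      FieldSum.sumN (suc (n ∸ z)) h                ∎
      where
      h = λ k → invFact k * coeff (X k) m
      range : suc (n ∸ z) ℕ.+ z ≡ suc n
      range = Eq.cong suc (ℕP.m∸n+n≡m fits)
      expansion : P-Z *P expT n L ≐ PolySum.sumN N (suc n) (λ k → invFact k ·P X k)
      expansion = ≐-trans (PolySum.sumN-*ˡ N (suc n) P-Z (λ k → invFact k ·P (L ^P k)))
                          (PolySum.sumN-cong N (suc n) (λ k _ → ·-*ʳ (invFact k) P-Z (L ^P k)))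
      high-vanishes : ∀ j → h (suc (n ∸ z) ℕ.+ j) ≈ 0#
      high-vanishes j = trans (*-congˡ (X-min (suc (n ∸ z) ℕ.+ j) m (λ le → ℕP.<⇒≱ n<deg (ℕP.≤-trans le (ℕP.≤-reflexive deg))))) (zeroʳ _)
        where
        n<deg : n < z ℕ.+ (suc (n ∸ z) ℕ.+ j)
        n<deg = ℕP.≤-trans (ℕP.≤-reflexive (Eq.sym (Eq.trans (ℕP.+-comm z (suc (n ∸ z))) range)))
                           (ℕP.+-monoʳ-≤ z (ℕP.m≤m+n (suc (n ∸ z)) j))

    degree-n-vanishes : ¬ (z ≤ n) → ∀ m → mdeg m ≡ n → coeff (ΠF d Q) m ≈ 0#
    degree-n-vanishes z≰n m deg = trans (coeff≈ product-split m)
      (minDeg-* P-Z P-U P-Z-min (minDeg-0 P-U) m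
        (λ le → z≰n (ℕP.≤-trans (ℕP.≤-trans (ℕP.≤-reflexive (Eq.sym (ℕP.+-identityʳ z))) le) (ℕP.≤-reflexive deg))))

    -- The level-3 gates: for j ∈ Z a gate computing HomLe n Rⱼ (= Rⱼ up to
    -- degree n), and one gate computing HomLe n of Σ_{j∈U} lg(Rⱼ) (= L up to
    -- degree n).
    gateZ : Fin d → SumGate3 N
    gateZ j = truncGate n Y (R j)

    gateL : SumGate3 N
    gateL = concatMap (λ j → truncGate n lg (R j)) U

    gates : ℕ → ProdGate2 N
    gates k = map gateZ Z ++ List.replicate k gateL

    gates-length : ∀ k → length (gates k) ≡ z ℕ.+ k
    gates-length k = Eq.trans (LP.length-++ (map gateZ Z)) (Eq.cong₂ ℕ._+_ (LP.length-map gateZ Z) (LP.length-replicate k))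

    gateZ-value : ∀ j → evalSum3 (gateZ j) ≈[ n ] R j
    gateZ-value j = beginK
      evalSum3 (gateZ j)        ≐K⟨ eval-truncGate n Y (R j) ⟩
      HomLe n (sub (R j) Y)     ≈K⟨ HomLe-≈K n (sub (R j) Y) ⟩
      sub (R j) Y               ≐K⟨ sub-Y (R j) ⟩
      R j                       ∎K

    gateL-value : ∀ xs → evalSum3 (concatMap (λ j → truncGate n lg (R j)) xs) ≈[ n ] sumP (map (λ j → sub (R j) lg) xs)
    gateL-value [] = ≈K-refl
    gateL-value (j ∷ xs) = beginK
      evalSum3 (truncGate n lg (R j) ++ rest)                  ≐K⟨ evalSum3-++ (truncGate n lg (R j)) rest ⟩
      evalSum3 (truncGate n lg (R j)) +P evalSum3 rest         ≈K⟨ ≈K-+ (≈K-trans (≐⇒≈K (eval-truncGate n lg (R j))) (HomLe-≈K n (sub (R j) lg)))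
                                                                        (gateL-value xs) ⟩
      sub (R j) lg +P sumP (map (λ j → sub (R j) lg) xs)       ∎K
      where rest = concatMap (λ j → truncGate n lg (R j)) xs

    gates-value : ∀ k → evalProd2 (gates k) ≈[ n ] X k
    gates-value k = beginK
      prodP (map evalSum3 (map gateZ Z ++ List.replicate k gateL))
        ≐K⟨ ≐-reflexive (Eq.cong prodP (LP.map-++ evalSum3 (map gateZ Z) (List.replicate k gateL))) ⟩
      prodP (map evalSum3 (map gateZ Z) ++ map evalSum3 (List.replicate k gateL))
        ≐K⟨ prodP-++ (map evalSum3 (map gateZ Z)) (map evalSum3 (List.replicate k gateL)) ⟩
      prodP (map evalSum3 (map gateZ Z)) *P prodP (map evalSum3 (List.replicate k gateL))
        ≐K⟨ ≐-reflexive (Eq.cong₂ (λ u v → prodP u *P v) (Eq.sym (LP.map-∘ Z))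
                                  (Eq.trans (Eq.cong prodP (LP.map-replicate evalSum3 k gateL)) (prodP-replicate k (evalSum3 gateL)))) ⟩
      prodP (map (λ j → evalSum3 (gateZ j)) Z) *P (evalSum3 gateL ^P k)
        ≈K⟨ ≈K-* (prodP-≈K Z (λ j → evalSum3 (gateZ j)) R gateZ-value) (^P-≈K k (gateL-value U)) ⟩
      P-Z *P (L ^P k) ∎K

    -- Every level-3 gate has degree ≤ n, so for k ≤ n - z the product gate has
    -- z + k ≤ n factors and degree ≤ n².
    gates-fanIn : z ≤ n → ∀ k → k ≤ n ∸ z → length (gates k) ≤ n
    gates-fanIn fits k k≤ = ℕP.≤-trans (ℕP.≤-reflexive (gates-length k))
                              (ℕP.≤-trans (ℕP.+-monoʳ-≤ z k≤) (ℕP.≤-reflexive (ℕP.m+[n∸m]≡n fits)))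

    truncGate-maxDeg : ∀ f (S : Pol N) → MaxDeg n (evalSum3 (truncGate n f S))
    truncGate-maxDeg f S = degreesIn-≐ {Q = _≤ n} (≐-sym (eval-truncGate n f S)) (HomLe-max n (sub S f))

    gateL-maxDeg : ∀ xs → MaxDeg n (evalSum3 (concatMap (λ j → truncGate n lg (R j)) xs))
    gateL-maxDeg [] m nq = refl
    gateL-maxDeg (j ∷ xs) = degreesIn-≐ {Q = _≤ n} (≐-sym (evalSum3-++ (truncGate n lg (R j)) _))
      (degreesIn-+ {Q = _≤ n} (evalSum3 (truncGate n lg (R j))) _ (truncGate-maxDeg lg (R j)) (gateL-maxDeg xs))

    gates-maxDeg : z ≤ n → ∀ k → k ≤ n ∸ z → MaxDeg (n ℕ.* n) (evalProd2 (gates k))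
    gates-maxDeg fits k k≤ = maxDeg-weaken factors (evalProd2 (gates k)) (prodP-maxDeg n (map evalSum3 (gates k)) (AllP.map⁺ each))
      where
      each : All (λ g → MaxDeg n (evalSum3 g)) (gates k)
      each = AllP.++⁺ (AllP.map⁺ (All.universal (λ j → truncGate-maxDeg Y (R j)) Z)) (AllP.replicate⁺ k (gateL-maxDeg U))
      factors : length (map evalSum3 (gates k)) ℕ.* n ≤ n ℕ.* n
      factors = ℕP.*-monoˡ-≤ n (ℕP.≤-trans (ℕP.≤-reflexive (LP.length-map evalSum3 (gates k))) (gates-fanIn fits k k≤))

    -- If z > n the
    -- summand contributes nothing in degree n and the circuit is empty.
    extractN : Scalings
    extractN = extractor (n ℕ.* n) n

    block : ℕ → Circuit N
    block k = scaledProducts extractN (α * invFact k) (gates k)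

    ks : List ℕ
    ks = downFrom (suc (n ∸ z))

    body : Circuit N
    body = concatMap block ks

    circuitFor : Dec (z ≤ n) → Circuit N
    circuitFor (yes _) = body
    circuitFor (no _) = []

    productCircuit : Circuit N
    productCircuit = circuitFor (z ℕ.≤? n)

    ks-small : All (_≤ n ∸ z) ks
    ks-small = AllP.applyDownFrom⁺₁ (λ k → k) (suc (n ∸ z)) ℕP.≤-pred

    blocks-value : z ≤ n → ∀ m → coeff (eval body) m ≈ α * sumL ks (λ k → invFact k * coeff (Hom n (X k)) m)
    blocks-value fits m = begin
      coeff (eval body) m                                ≈⟨ coeff-eval body m ⟩
      sumL body G                                        ≈⟨ sumL-concatMap ks block G ⟩
      sumL ks (λ k → sumL (block k) G)                   ≈⟨ sumL-congAll ks ks-small (λ k k≤ → trans (sym (coeff-eval (block k) m)) (block-value k k≤)) ⟩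
      sumL ks (λ k → α * (invFact k * coeff (Hom n (X k)) m)) ≈⟨ sym (sumL-*ˡ ks α _) ⟩
      α * sumL ks (λ k → invFact k * coeff (Hom n (X k)) m) ∎
      where
      G = λ (t : Carrier × ProdGate2 N) → proj₁ t * coeff (evalProd2 (proj₂ t)) m
      block-value : ∀ k → k ≤ n ∸ z → coeff (eval (block k)) m ≈ α * (invFact k * coeff (Hom n (X k)) m)
      block-value k k≤ = begin
        coeff (eval (block k)) m                                   ≈⟨ coeff-scaledProducts extractN (α * invFact k) (gates k) m ⟩
        (α * invFact k) * coeff (applyScalings extractN (evalProd2 (gates k))) m
                                                                   ≈⟨ *-congˡ (coeff≈ (extract (n ℕ.* n) n _ (gates-maxDeg fits k k≤)) m) ⟩
        (α * invFact k) * coeff (Hom n (evalProd2 (gates k))) m    ≈⟨ *-congˡ (coeff≈ (Hom-≈K n (gates-value k)) m) ⟩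
        (α * invFact k) * coeff (Hom n (X k)) m                    ≈⟨ *-assoc _ _ _ ⟩
        α * (invFact k * coeff (Hom n (X k)) m)                    ∎

    productCircuit-value : ∀ m → coeff (eval productCircuit) m ≈ α * coeff (Hom n (ΠF d Q)) m
    productCircuit-value m = byCases (z ℕ.≤? n) (mdeg m ℕ.≟ n)
      where
      rhs-outside : ¬ (mdeg m ≡ n) → α * coeff (Hom n (ΠF d Q)) m ≈ 0#
      rhs-outside ne = trans (*-congˡ (filterDeg-out (ℕ._≟ n) (ΠF d Q) m ne)) (zeroʳ _)
      byCases : ∀ D → Dec (mdeg m ≡ n) → coeff (eval (circuitFor D)) m ≈ α * coeff (Hom n (ΠF d Q)) m
      byCases (yes fits) (yes deg) = begin
        coeff (eval body) m                                              ≈⟨ blocks-value fits m ⟩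
        α * sumL ks (λ k → invFact k * coeff (Hom n (X k)) m)            ≈⟨ *-congˡ (sumL-cong ks (λ k → *-congˡ (filterDeg-in (ℕ._≟ n) (X k) m deg))) ⟩
        α * sumL ks (λ k → invFact k * coeff (X k) m)                    ≈⟨ *-congˡ (FieldSum.sumL-downFrom (suc (n ∸ z)) _) ⟩
        α * FieldSum.sumN (suc (n ∸ z)) (λ k → invFact k * coeff (X k) m) ≈⟨ *-congˡ (sym (degree-n-expansion fits m deg)) ⟩
        α * coeff (ΠF d Q) m                                             ≈⟨ *-congˡ (sym (filterDeg-in (ℕ._≟ n) (ΠF d Q) m deg)) ⟩
        α * coeff (Hom n (ΠF d Q)) m                                     ∎
      byCases (yes fits) (no ne) =
        trans (blocks-value fits m)
              (trans (*-congˡ (sumL-0 ks _ (λ k → trans (*-congˡ (filterDeg-out (ℕ._≟ n) (X k) m ne)) (zeroʳ _))))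
                     (trans (zeroʳ α) (sym (rhs-outside ne))))
      byCases (no z≰n) (yes deg) =
        sym (trans (*-congˡ (trans (filterDeg-in (ℕ._≟ n) (ΠF d Q) m deg) (degree-n-vanishes z≰n m deg))) (zeroʳ _))
      byCases (no z≰n) (no ne) = sym (rhs-outside ne)

    productCircuit-fanIn : All (λ t → length (proj₂ t) ≤ n) productCircuit
    productCircuit-fanIn = byCases (z ℕ.≤? n)
      where
      byCases : ∀ D → All (λ t → length (proj₂ t) ≤ n) (circuitFor D)
      byCases (no _) = []
      byCases (yes fits) = AllP.concat⁺ (AllP.map⁺ (All.map (λ {k} k≤ → AllP.map⁺ (All.universal (λ o →
        ℕP.≤-trans (ℕP.≤-reflexive (LP.length-map (scaleGate (proj₂ o)) (gates k))) (gates-fanIn fits k k≤)) extractN)) ks-small))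

    -- There are at most n + 1 blocks of at most n² + 2 product gates each.
    productCircuit-size : length productCircuit ≤ suc n ℕ.* suc (suc (n ℕ.* n))
    productCircuit-size = byCases (z ℕ.≤? n)
      where
      byCases : ∀ D → length (circuitFor D) ≤ suc n ℕ.* suc (suc (n ℕ.* n))
      byCases (no _) = ℕ.z≤n
      byCases (yes _) = ℕP.≤-trans
        (length-concatMap≤ block (suc (suc (n ℕ.* n))) ks (λ k → ℕP.≤-trans (ℕP.≤-reflexive (LP.length-map _ extractN)) (extractor-length (n ℕ.* n) n)))
        (ℕP.*-monoˡ-≤ (suc (suc (n ℕ.* n))) (ℕP.≤-trans (ℕP.≤-reflexive (LP.length-downFrom (suc (n ∸ z)))) (ℕ.s≤s (ℕP.m∸n≤m n z))))

    -- Every ∧-input is a sibling of some Rⱼ: the level-3 gates feed scalings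
    -- R(σX) of the Rⱼ, and the outer extraction scales these once more.
    SiblingInput : Carrier × PowGate N → Set (a Level.⊔ ℓ)
    SiblingInput u = Σ (Fin d) λ j → IsSibling (proj₂ (proj₂ u)) (R j)

    gates-siblings : ∀ k → All (All (λ u → Σ (Fin d) λ j → SiblingEntry (R j) u)) (gates k)
    gates-siblings k = AllP.++⁺ (AllP.map⁺ (All.universal (λ j → All.map (j ,_) (truncGate-siblings n Y (R j))) Z))
      (AllP.replicate⁺ k (AllP.concat⁺ (AllP.map⁺ (All.universal (λ j → All.map (j ,_) (truncGate-siblings n lg (R j))) U))))

    scaled-siblings : ∀ {σ} → Nonzero σ → (g : SumGate3 N) → All (λ u → Σ (Fin d) λ j → SiblingEntry (R j) u) g →
      All SiblingInput (scaleGate σ g)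
    scaled-siblings {σ} σ≉0 g hg = AllP.map⁺ (All.map (λ { (j , σ' , σ'≉0 , Eq.refl) →
      j , σ * σ' , nonzero-* σ≉0 σ'≉0 , coeff≈ (scaleVars-comp σ σ' (R j)) }) hg)

    productCircuit-siblings : All (λ t → All (All SiblingInput) (proj₂ t)) productCircuit
    productCircuit-siblings = byCases (z ℕ.≤? n)
      where
      byCases : ∀ D → All (λ t → All (All SiblingInput) (proj₂ t)) (circuitFor D)
      byCases (no _) = []
      byCases (yes _) = AllP.concat⁺ (AllP.map⁺ (All.universal (λ k → AllP.map⁺ (All.map (λ {o} σ≉0 →
        AllP.map⁺ (All.map (λ {g} hg → scaled-siblings σ≉0 g hg) (gates-siblings k))) (extractor-nonzero (n ℕ.* n) n))) ks))

  -- The circuit is the concatenation over i of the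
  -- circuits for the summands αᵢ · Πⱼ Qᵢⱼ; since P is homogeneous of degree n,
  -- it equals Σᵢ αᵢ · Hom n (Πⱼ Qᵢⱼ), which is what the circuit computes.
  coeff-ΣF : ∀ {N} T (f : Fin T → Pol N) m → coeff (ΣF T f) m ≈ sumL (List.allFin T) (λ i → coeff (f i) m)
  coeff-ΣF T f m = trans (coeff-sumP (List.tabulate f) m)
    (trans (reflexive (Eq.cong (λ w → sumL w (λ p → coeff p m)) (Eq.sym (LP.map-tabulate (λ i → i) f)))) (sumL-map (List.allFin T) f _))

  homogeneous-sum : ∀ {N} n T (P : Pol N) (α : Fin T → Carrier) (Π : Fin T → Pol N) →
    Homogeneous n P → P ≋ ΣF T (λ i → α i ·P Π i) → ∀ m → coeff P m ≈ sumL (List.allFin T) (λ i → α i * coeff (Hom n (Π i)) m)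
  homogeneous-sum n T P α Π hom hP m with mdeg m ℕ.≟ n
  ... | yes deg = begin
    coeff P m                                                     ≈⟨ hP m ⟩
    coeff (ΣF T (λ i → α i ·P Π i)) m                             ≈⟨ coeff-ΣF T _ m ⟩
    sumL (List.allFin T) (λ i → coeff (α i ·P Π i) m)             ≈⟨ sumL-cong (List.allFin T) (λ i →
                                                                       trans (coeff-· (α i) (Π i) m) (*-congˡ (sym (filterDeg-in (ℕ._≟ n) (Π i) m deg)))) ⟩
    sumL (List.allFin T) (λ i → α i * coeff (Hom n (Π i)) m)      ∎
  ... | no ne = trans (hom m ne) (sym (sumL-0 (List.allFin T) _ (λ i → trans (*-congˡ (filterDeg-out (ℕ._≟ n) (Π i) m ne)) (zeroʳ _))))

  module Assembly {N n T d : ℕ} (lg : Pol 1) (lg-terms : TermsIn (1 ≤_) lg) (lg-log : expT n lg ≈[ n ] κ 1# +P Y)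
                  (α : Fin T → Carrier) (Q : Fin T → Fin d → Pol N)
                  (hc : ∀ i j → (constTerm (Q i j) ≈ 0#) ⊎ (constTerm (Q i j) ≈ 1#)) where
    module PC (i : Fin T) = ProductCircuit n lg lg-terms lg-log (Q i) (hc i) (α i)

    circuit : Circuit N
    circuit = concatMap PC.productCircuit (List.allFin T)

    circuit-value : ∀ m → coeff (eval circuit) m ≈ sumL (List.allFin T) (λ i → α i * coeff (Hom n (ΠF d (Q i))) m)
    circuit-value m = begin
      coeff (eval circuit) m                                   ≈⟨ coeff-eval circuit m ⟩
      sumL circuit G                                           ≈⟨ sumL-concatMap (List.allFin T) PC.productCircuit G ⟩
      sumL (List.allFin T) (λ i → sumL (PC.productCircuit i) G) ≈⟨ sumL-cong (List.allFin T) (λ i →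
                                                                     trans (sym (coeff-eval (PC.productCircuit i) m)) (PC.productCircuit-value i m)) ⟩
      sumL (List.allFin T) (λ i → α i * coeff (Hom n (ΠF d (Q i))) m) ∎
      where G = λ (t : Carrier × ProdGate2 N) → proj₁ t * coeff (evalProd2 (proj₂ t)) m

    circuit-fanIn : Level2FanInAtMost n circuit
    circuit-fanIn = AllP.concat⁺ (AllP.map⁺ (All.universal PC.productCircuit-fanIn (List.allFin T)))

    circuit-size : topFanIn circuit ≤ T ℕ.* (suc n ℕ.* suc (suc (n ℕ.* n)))
    circuit-size = ℕP.≤-trans (length-concatMap≤ PC.productCircuit _ (List.allFin T) PC.productCircuit-size)
                              (ℕP.≤-reflexive (Eq.cong (ℕ._* _) (LP.length-tabulate {n = T} (λ i → i))))

    SiblingOfSome : Pol N → Set (a Level.⊔ ℓ)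
    SiblingOfSome S = Σ (Fin T) λ i → Σ (Fin d) λ j → IsSibling S (Hom≥1 (Q i j))

    circuit-siblings : ∀ S → S ∈ powInputs circuit → SiblingOfSome S
    circuit-siblings S S∈ = All.lookup inputs S∈
      where
      gates-ok : All (λ t → All (All (λ u → SiblingOfSome (proj₂ (proj₂ u)))) (proj₂ t)) circuit
      gates-ok = AllP.concat⁺ (AllP.map⁺ (All.universal (λ i →
        All.map (All.map (All.map (λ { (j , sib) → i , j , sib }))) (PC.productCircuit-siblings i)) (List.allFin T)))
      inputs : All SiblingOfSome (powInputs circuit)
      inputs = AllP.concat⁺ (AllP.map⁺ (All.map (λ gs → AllP.concat⁺ (AllP.map⁺ (All.map AllP.map⁺ gs))) gates-ok))

  -- With no factors every summand is constant, so a homogeneous P of degree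
  -- n ≥ 1 is zero and the empty circuit computes it.
  constant-summands : ∀ {N} n T (P : Pol N) (α : Fin T → Carrier) (Q : Fin T → Fin 0 → Pol N) → 1 ≤ n →
    Homogeneous n P → P ≋ ΣF T (λ i → α i ·P ΠF 0 (Q i)) → eval {N} [] ≋ P
  constant-summands {N} n T P α Q 1≤n hom hP m = sym (trans (homogeneous-sum n T P α (λ i → ΠF 0 (Q i)) hom hP m)
    (sumL-0 (List.allFin T) _ (λ i → trans (*-congˡ (Hom-1 (mdeg m ℕ.≟ n))) (zeroʳ _))))
    where
    Hom-1 : Dec (mdeg m ≡ n) → coeff (Hom n (constP {N} 1#)) m ≈ 0#
    Hom-1 (yes deg) = trans (filterDeg-in (ℕ._≟ n) (constP 1#) m deg) (maxDeg-const1 m (λ m≤0 → ℕP.<⇒≱ 1≤n (Eq.subst (_≤ 0) deg m≤0)))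
    Hom-1 (no ne) = filterDeg-out (ℕ._≟ n) (constP 1#) m ne

  theorem : (N n T d s : ℕ) → 1 ℕ.≤ n →
    (P : Pol N) → Homogeneous n P →
    (α : Fin T → Carrier) → (Q : Fin T → Fin d → Pol N) →
    (∀ i j → DependsOnAtMost s (Q i j)) →
    (∀ i j → (constTerm (Q i j) ≈ 0#) ⊎ (constTerm (Q i j) ≈ 1#)) →
    P ≋ ΣF T (λ i → α i ·P ΠF d (λ j → Q i j)) →
    Σ (Circuit N) λ C →
      (eval C ≋ P) ×
      (∀ R → R ∈ powInputs C → Σ (Fin T) λ i → Σ (Fin d) λ j → IsSibling R (Hom≥1 (Q i j))) ×
      Level2FanInAtMost n C ×
      (∀ k → n ℕ.≤ k ℕ.* k → topFanIn C ℕ.≤ T ℕ.* (d ℕ.^ 2) ℕ.* (n ℕ.^ 3) ℕ.* (2 ℕ.^ (3 ℕ.* k)))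
  theorem N n T zero s 1≤n P hom α Q _ hc hP =
    [] , constant-summands n T P α Q 1≤n hom hP , (λ R ()) , [] , (λ k _ → ℕ.z≤n)
  theorem N n T d@(suc _) s 1≤n P hom α Q _ hc hP with truncatedLog n n 1≤n ℕP.≤-refl
  ... | lg , lg-terms , lg-log = circuit , value , circuit-siblings , circuit-fanIn , size
    where
    open Assembly {N} {n} {T} {d} lg lg-terms lg-log α Q hc
    value : eval circuit ≋ P
    value m = trans (circuit-value m) (sym (homogeneous-sum n T P α (λ i → ΠF d (Q i)) hom hP m))
    size : ∀ k → n ≤ k ℕ.* k → topFanIn circuit ≤ T ℕ.* (d ℕ.^ 2) ℕ.* (n ℕ.^ 3) ℕ.* (2 ℕ.^ (3 ℕ.* k))
    size k n≤k² = ℕP.≤-trans circuit-size (FanInArithmetic.topFanInBound T d n k (ℕ.s≤s ℕ.z≤n) 1≤n n≤k²)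

corollary4p6 : ∀ {a ℓ : Level} → Σ ℕ λ c →
    (F : CharZeroField a ℓ) → let open Poly F in
    (N n T d s : ℕ) → 1 ℕ.≤ n →
    (P : Pol N) → Homogeneous n P →
    (α : Fin T → Carrier) → (Q : Fin T → Fin d → Pol N) →
    (∀ i j → DependsOnAtMost s (Q i j)) →
    (∀ i j → (constTerm (Q i j) ≈ 0#) ⊎ (constTerm (Q i j) ≈ 1#)) →
    P ≋ ΣF T (λ i → α i ·P ΠF d (λ j → Q i j)) →
    Σ (Circuit N) λ C →
      (eval C ≋ P) ×
      (∀ R → R ∈ powInputs C → Σ (Fin T) λ i → Σ (Fin d) λ j → IsSibling R (Hom≥1 (Q i j))) ×
      Level2FanInAtMost n C ×
      (∀ k → n ℕ.≤ k ℕ.* k → topFanIn C ℕ.≤ T ℕ.* (d ℕ.^ 2) ℕ.* (n ℕ.^ 3) ℕ.* (2 ℕ.^ (c ℕ.* k)))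
corollary4p6 = 3 , Construction.theorem
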